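{- Let $s,t$ be integers with $s,t>1$ and $\gcd(s,t)=1$, and let $\omega_s=e^{2\pi I/s}$, $I=\sqrt{ -1}$. Then for every $t$-core $\pi$, \[ \mathrm{GBG\text{ - }rank}(\pi,s)=\frac{\sum_{i=0}^{t-1}\omega_s^{\,i+1}\bigl(\omega_s^{\,t\,n_i(\pi,t)}-1\bigr)}{(1-\omega_s)(1-\omega_s^{t})}. \]
   Context: For a partition $\pi$, its Young diagram has cells $(i,j)$ (row $i$, column $j$, $i,j\ge1$). For an integer $m\ge 1$ and $0\le k\le m-1$, $r_k(\pi,m)$ denotes the number of cells $(i,j)$ of the diagram of $\pi$ with $j-i\equiv k \pmod m$. The GBG-rank of $\pi$ mod $s$ is $\mathrm{GBG\text{ - }rank}(\pi,s)=\sum_{k=0}^{s-1} r_k(\pi,s)\,\omega_s^{k}$. For $0\le i\le t-1$, $n_i(\pi,t)=r_i(\pi,t)-r_{i+1}(\pi,t)$, with indices taken mod $t$ (so $n_{t-1}(\pi,t)=r_{t-1}(\pi,t)-r_0(\pi,t)$). A rim cell of $\pi$ is a cell sharing a vertex or edge with the rim (boundary) of the diagram; a rim hook is a connected collection of rim cells whose removal leaves the diagram of a partition. $\pi$ is a $t$-core if its diagram has no rim hook of length $t$. -}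

module Defs where

open import Level using (Level; _⊔_)
open import Data.Nat as ℕ using (ℕ; zero; suc; _≤_; _<_; NonZero)
open import Data.Nat.Properties using (_≟_)
open import Data.Integer as ℤ using (ℤ; +_; _%ℕ_)
open import Data.List using (List; []; _∷_)
open import Data.Nat.ListAction using (sum)
open import Data.List.Relation.Unary.All using (All)
open import Data.List.Relation.Unary.Linked using (Linked)
open import Data.Product using (_×_; Σ; ∃; _,_)
open import Data.Sum using (_⊎_)
open import Relation.Nullary using (¬_; does)
open import Data.Bool using (if_then_else_)
open import Relation.Binary.PropositionalEquality using (_≡_)
open import Algebra.Bundles using (CommutativeRing)

IsPartition : List ℕ → Set
IsPartition λs = All (λ x → 0 < x) λs × Linked ℕ._≥_ λs

-- Cells are pairs (row i, column j), 1-indexed.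
Cell : Set
Cell = ℕ × ℕ

-- length of row i (1-indexed); 0 for rows beyond the partition
part : List ℕ → ℕ → ℕ
part []       _             = 0
part (x ∷ xs) zero          = 0
part (x ∷ xs) (suc zero)    = x
part (x ∷ xs) (suc (suc i)) = part xs (suc i)

_∈D_ : Cell → List ℕ → Set
(i , j) ∈D λs = (1 ≤ i) × (1 ≤ j) × (j ≤ part λs i)

Adjacent : Cell → Cell → Set
Adjacent (i , j) (i' , j') =
  (i ≡ i' × (suc j ≡ j' ⊎ suc j' ≡ j)) ⊎ (j ≡ j' × (suc i ≡ i' ⊎ suc i' ≡ i))

data Walk (S : Cell → Set) : Cell → Cell → Set where
  here : ∀ {c} → S c → Walk S c c
  step : ∀ {c d e} → S c → Adjacent c d → Walk S d e → Walk S c e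

Connected : (Cell → Set) → Set
Connected S = ∀ a b → S a → S b → Walk S a b

RimCell : List ℕ → Cell → Set
RimCell λs (i , j) = (i , j) ∈D λs × ¬ ((suc i , suc j) ∈D λs)

Skew : List ℕ → List ℕ → Cell → Set
Skew λs μs c = c ∈D λs × ¬ (c ∈D μs)

IsRimHook : ℕ → List ℕ → List ℕ → Set
IsRimHook t λs μs =
  IsPartition μs
  × (∀ c → c ∈D μs → c ∈D λs)
  × (sum λs ≡ sum μs ℕ.+ t)
  × (∀ c → Skew λs μs c → RimCell λs c)
  × Connected (Skew λs μs)

IsCore : ℕ → List ℕ → Set
IsCore t λs = ¬ (Σ (List ℕ) λ μs → IsRimHook t λs μs)

-- r_k(π,m): number of cells (i,j) with j - i ≡ k (mod m)

rowCount : (m k i l : ℕ) .{{_ : NonZero m}} → ℕ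
rowCount m k i zero    = 0
rowCount m k i (suc l) =
  (if does (((+ suc l) ℤ.- (+ i)) %ℕ m ≟ k) then 1 else 0) ℕ.+ rowCount m k i l

rowsCount : (m k i : ℕ) .{{_ : NonZero m}} → List ℕ → ℕ
rowsCount m k i []       = 0
rowsCount m k i (l ∷ ls) = rowCount m k i l ℕ.+ rowsCount m k (suc i) ls

r : (k : ℕ) → List ℕ → (m : ℕ) .{{_ : NonZero m}} → ℕ
r k λs m = rowsCount m k 1 λs

nn : (i : ℕ) → List ℕ → (t : ℕ) .{{_ : NonZero t}} → ℤ
nn i λs t = (+ r i λs t) ℤ.- (+ r ((suc i) ℕ.% t) λs t)

-- Ring-valued quantities (the paper works in ℂ with ω = e^{2πI/s})

module RingDefs {c ℓ : Level} (R : CommutativeRing c ℓ) where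
  open CommutativeRing R

  pow : Carrier → ℕ → Carrier
  pow x zero    = 1#
  pow x (suc n) = x * pow x n

  fromℕ : ℕ → Carrier
  fromℕ zero    = 0#
  fromℕ (suc n) = 1# + fromℕ n

  sumTo : ℕ → (ℕ → Carrier) → Carrier
  sumTo zero    f = 0#
  sumTo (suc n) f = sumTo n f + f n

  PrimitiveRoot : ℕ → Carrier → Set ℓ
  PrimitiveRoot s ω = (pow ω s ≈ 1#) × (∀ k → 0 < k → k < s → ¬ (pow ω k ≈ 1#))

  -- ω^z for an integer exponent z, where ω^s = 1 (exponent reduced mod s)
  powℤ : (s : ℕ) .{{_ : NonZero s}} → Carrier → ℤ → Carrier
  powℤ s ω z = pow ω (z %ℕ s)

  GBGrank : List ℕ → (s : ℕ) .{{_ : NonZero s}} → Carrier → Carrier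
  GBGrank λs s ω = sumTo s (λ k → fromℕ (r k λs s) * pow ω k)

  numerator : List ℕ → (s t : ℕ) .{{_ : NonZero s}} .{{_ : NonZero t}} → Carrier → Carrier
  numerator λs s t ω =
    sumTo t (λ i → pow ω (suc i) * (powℤ s ω ((+ t) ℤ.* nn i λs t) - 1#))

  denominator : ℕ → Carrier → Carrier
  denominator t ω = (1# - ω) * (1# - pow ω t)

-- Proof via James' abacus. Pad π with empty rows to N = L·t rows (L the
-- number of parts); its beta-numbers β_i = π_i + (N - i) are strictly
-- decreasing, and the row offsets N - i run through 0, …, N - 1.
--  * Combinatorics: if a bead β could be moved t places down to an empty
--    position, the corresponding rim hook of length t could be removed; so
--    for a t-core the beta-set is closed under β ↦ β - t (core⇒shift-closed).
--  * Counting: a shift-closed set fills each runner k (residue class mod t)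
--    from the bottom with c_k beads; telescoping the cell counts row by row
--    gives n_k(π, t) = c_k - L (n-formula).
--  * Algebra: the cell (i, j) contributes ω^{j-i} = ω^{-N} ω^{j+o}, o = N - i,
--    so the rows are geometric sums; multiplying by (1 - ω) and (1 - ω^t)
--    telescopes rows into beads and runners into their tops ω^{k + t c_k}
--    (rows-geometric, shift-closed-sum), and eliminating the auxiliary sums
--    yields GBG-rank · (1 - ω)(1 - ω^t) = numerator (gbg-times-denominator).
module Submission where

open import Defs
open import Level using (Level)
open import Data.Nat using (ℕ; zero; suc; _<_; NonZero)
open import Data.Nat.GCD using (gcd)
open import Data.List using (List)
open import Data.Product using (_,_)
open import Relation.Binary.PropositionalEquality using (_≡_)
open import Algebra.Bundles using (CommutativeRing)

module Walks where

  open import Defs using (Cell; Adjacent; Walk; here; step; Connected)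
  open import Data.Nat using (zero; suc; _+_; _≤_)
  open import Data.Nat.Properties
  open import Data.Product using (_,_)
  open import Data.Sum using (inj₁; inj₂)
  open import Relation.Binary.PropositionalEquality

  module _ {S : Cell → Set} where

    walk-start : ∀ {a b} → Walk S a b → S a
    walk-start (here s)     = s
    walk-start (step s _ _) = s

    walk-end : ∀ {a b} → Walk S a b → S b
    walk-end (here s)     = s
    walk-end (step _ _ w) = walk-end w

    _++ʷ_ : ∀ {a b c} → Walk S a b → Walk S b c → Walk S a c
    here _       ++ʷ w′ = w′
    step s adj w ++ʷ w′ = step s adj (w ++ʷ w′)

  adjacent-sym : ∀ {c d} → Adjacent c d → Adjacent d c
  adjacent-sym (inj₁ (refl , inj₁ e)) = inj₁ (refl , inj₂ e)
  adjacent-sym (inj₁ (refl , inj₂ e)) = inj₁ (refl , inj₁ e)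
  adjacent-sym (inj₂ (refl , inj₁ e)) = inj₂ (refl , inj₂ e)
  adjacent-sym (inj₂ (refl , inj₂ e)) = inj₂ (refl , inj₁ e)

  walk-reverse : ∀ {S a b} → Walk S a b → Walk S b a
  walk-reverse (here s)       = here s
  walk-reverse (step s adj w) =
    walk-reverse w ++ʷ step (walk-start w) (adjacent-sym adj) (here s)

  walk-map : ∀ {S S′ : Cell → Set} (f : Cell → Cell) →
    (∀ c → S c → S′ (f c)) → (∀ c d → Adjacent c d → Adjacent (f c) (f d)) →
    ∀ {a b} → Walk S a b → Walk S′ (f a) (f b)
  walk-map f fS fA (here s)       = here (fS _ s)
  walk-map f fS fA (step s adj w) = step (fS _ s) (fA _ _ adj) (walk-map f fS fA w)

  reach⇒connected : ∀ {S e} → (∀ c → S c → Walk S c e) → Connected S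
  reach⇒connected reach a b sa sb = reach a sa ++ʷ walk-reverse (reach b sb)

  segment-walk : ∀ {S : Cell → Set} i j d →
    (∀ j′ → j ≤ j′ → j′ ≤ j + d → S (i , j′)) → Walk S (i , j) (i , j + d)
  segment-walk i j zero inS rewrite +-identityʳ j = here (inS j ≤-refl ≤-refl)
  segment-walk i j (suc d) inS rewrite +-suc j d =
    step (inS j ≤-refl (m≤n⇒m≤1+n (m≤m+n j d))) (inj₁ (refl , inj₁ refl))
      (segment-walk i (suc j) d λ j′ j<j′ j′≤ → inS j′ (<⇒≤ j<j′) j′≤)

module RimHooks where

  open import Defs
  open Walks
  open import Data.Nat using (ℕ; zero; suc; _+_; _∸_; _≤_; _<_; _≥_; z≤n; s≤s)
  open import Data.Nat.Properties
  open import Data.Nat.ListAction using (sum)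
  open import Data.List using (List; []; _∷_)
  open import Data.List.Relation.Unary.Linked using (Linked; []; [-]; _∷_)
  open import Data.Product using (_×_; _,_; proj₁)
  open import Data.Sum using (inj₁; inj₂)
  open import Data.Empty using (⊥-elim)
  open import Relation.Binary.PropositionalEquality
  open import Data.Nat.Tactic.RingSolver using (solve-∀)

  ∈D-down : ∀ x xs {i j} → (suc i , j) ∈D xs → (suc (suc i) , j) ∈D (x ∷ xs)
  ∈D-down x xs (_ , b , c) = s≤s z≤n , b , c

  ∈D-up : ∀ x xs {i j} → (suc (suc i) , j) ∈D (x ∷ xs) → (suc i , j) ∈D xs
  ∈D-up x xs (_ , b , c) = s≤s z≤n , b , c

  skew-up : ∀ x xs y ys {i j} → Skew (x ∷ xs) (y ∷ ys) (suc (suc i) , j) → Skew xs ys (suc i , j)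
  skew-up x xs y ys (a , na) = ∈D-up x xs a , λ b → na (∈D-down y ys b)

  rim-down : ∀ x xs {i j} → RimCell xs (suc i , j) → RimCell (x ∷ xs) (suc (suc i) , j)
  rim-down x xs {i} {j} (a , nd) = ∈D-down x xs a , λ b → nd (∈D-up x xs {suc i} {suc j} b)

  shift-down : Cell → Cell
  shift-down (i , j) = (suc i , j)

  adjacent-down : ∀ c d → Adjacent c d → Adjacent (shift-down c) (shift-down d)
  adjacent-down _ _ (inj₁ (e , r))       = inj₁ (cong suc e , r)
  adjacent-down _ _ (inj₂ (e , inj₁ r)) = inj₂ (e , inj₁ (cong suc r))
  adjacent-down _ _ (inj₂ (e , inj₂ r)) = inj₂ (e , inj₂ (cong suc r))

  skew-down : ∀ x xs y ys c → Skew xs ys c → Skew (x ∷ xs) (y ∷ ys) (shift-down c)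
  skew-down x xs y ys (zero , j)  ((() , _) , _)
  skew-down x xs y ys (suc i , j) (a , na) = ∈D-down x xs a , λ b → na (∈D-up y ys b)

  first-row-skew : ∀ {ℓ μ j} → 1 ≤ j → j ≤ part ℓ 1 → part μ 1 < j → Skew ℓ μ (1 , j)
  first-row-skew 1≤j j≤ μ<j = (s≤s z≤n , 1≤j , j≤) , λ (_ , _ , j≤μ) → <⇒≱ μ<j j≤μ

  first-row-skew⁻¹ : ∀ {ℓ μ j} → Skew ℓ μ (1 , j) → (1 ≤ j) × (part μ 1 < j) × (j ≤ part ℓ 1)
  first-row-skew⁻¹ ((_ , 1≤j , j≤) , ∉μ) = 1≤j , ≰⇒> (λ j≤μ → ∉μ (s≤s z≤n , 1≤j , j≤μ)) , j≤

  first-row-reach : ∀ {ℓ μ j} → Skew ℓ μ (1 , j) → Walk (Skew ℓ μ) (1 , j) (1 , part ℓ 1)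
  first-row-reach {ℓ} {μ} {j} sk with first-row-skew⁻¹ {ℓ} {μ} sk
  ... | 1≤j , μ<j , j≤x =
    subst (λ x → Walk (Skew ℓ μ) (1 , j) (1 , x)) (m+[n∸m]≡n j≤x)
      (segment-walk 1 j (part ℓ 1 ∸ j) λ j′ j≤j′ j′≤ →
        first-row-skew {ℓ} {μ} (≤-trans 1≤j j≤j′)
          (≤-trans j′≤ (≤-reflexive (m+[n∸m]≡n j≤x))) (<-≤-trans μ<j j≤j′))

  -- Shapes of rim hooks of length k starting at the last cell of the first
  -- row, described row by row from the top.
  data HookShape : ℕ → List ℕ → Set where
    -- the hook is the last k cells of the first row, which overhang the
    -- second row (part ys 1) by at least k
    within-row : ∀ {k x ys} → 1 ≤ k → k + part ys 1 ≤ x → HookShape k (x ∷ ys)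
    -- the hook takes the cells y … y + d of the first row and continues as
    -- a hook of length k′ of the remaining rows, starting at (2 , y)
    down-row : ∀ {k′ d y ys} → HookShape k′ (y ∷ ys) → HookShape (k′ + suc d) (y + d ∷ y ∷ ys)

  record HookRemoval (k : ℕ) (ℓ : List ℕ) : Set where
    field
      μ          : List ℕ
      decreasing : Linked _≥_ μ
      inside     : ∀ c → c ∈D μ → c ∈D ℓ
      size       : sum ℓ ≡ sum μ + k
      on-rim     : ∀ c → Skew ℓ μ c → RimCell ℓ c
      reach      : ∀ c → Skew ℓ μ c → Walk (Skew ℓ μ) c (1 , part ℓ 1)
      shortens   : part μ 1 < part ℓ 1

  linked-∷ : ∀ {a μ} → part μ 1 ≤ a → Linked _≥_ μ → Linked _≥_ (a ∷ μ)
  linked-∷ {μ = []}    _  _ = [-]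
  linked-∷ {μ = _ ∷ _} le l = le ∷ l

  linked-tail : ∀ {x xs} → Linked _≥_ (x ∷ xs) → Linked _≥_ xs
  linked-tail [-]     = []
  linked-tail (_ ∷ l) = l

  remove-within-row : ∀ {k x ys} → Linked _≥_ (x ∷ ys) → 1 ≤ k → k + part ys 1 ≤ x →
    HookRemoval k (x ∷ ys)
  remove-within-row {k} {x} {ys} lnk 1≤k k+y≤x = record
    { μ = x ∸ k ∷ ys ; decreasing = linked-∷ y≤x∸k (linked-tail lnk)
    ; inside = inside ; size = size ; on-rim = on-rim ; reach = reach
    ; shortens = ∸-monoʳ-< 1≤k k≤x }
    where
    ℓ = x ∷ ys
    μ = x ∸ k ∷ ys
    k≤x : k ≤ x
    k≤x = ≤-trans (m≤m+n k (part ys 1)) k+y≤x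
    y≤x∸k : part ys 1 ≤ x ∸ k
    y≤x∸k = subst (_≤ x ∸ k) (m+n∸m≡n k (part ys 1)) (∸-monoˡ-≤ k k+y≤x)
    inside : ∀ c → c ∈D μ → c ∈D ℓ
    inside (suc zero , j)    (a , b , c) = a , b , ≤-trans c (m∸n≤m x k)
    inside (suc (suc i) , j) p           = p
    size : x + sum ys ≡ (x ∸ k + sum ys) + k
    size = begin
      x + sum ys           ≡⟨ cong (_+ sum ys) (sym (m∸n+n≡m k≤x)) ⟩
      x ∸ k + k + sum ys   ≡⟨ +-assoc (x ∸ k) k (sum ys) ⟩
      x ∸ k + (k + sum ys) ≡⟨ cong (x ∸ k +_) (+-comm k (sum ys)) ⟩
      x ∸ k + (sum ys + k) ≡⟨ +-assoc (x ∸ k) (sum ys) k ⟨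
      x ∸ k + sum ys + k   ∎
      where open ≡-Reasoning
    on-rim : ∀ c → Skew ℓ μ c → RimCell ℓ c
    on-rim (suc zero , j) sk with first-row-skew⁻¹ {ℓ} {μ} sk
    ... | _ , x∸k<j , _ = proj₁ sk , λ (_ , _ , j<y) →
          <⇒≱ (≤-<-trans y≤x∸k x∸k<j) (≤-trans (n≤1+n j) j<y)
    on-rim (suc (suc i) , j) (a , ∉μ) = ⊥-elim (∉μ a)
    reach : ∀ c → Skew ℓ μ c → Walk (Skew ℓ μ) c (1 , x)
    reach (suc zero , j)    sk       = first-row-reach {ℓ} {μ} sk
    reach (suc (suc i) , j) (a , ∉μ) = ⊥-elim (∉μ a)

  extend-down : ∀ {k′ d y₀ ys} → HookRemoval k′ (suc y₀ ∷ ys) →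
    HookRemoval (k′ + suc d) (suc y₀ + d ∷ suc y₀ ∷ ys)
  extend-down {k′} {d} {y₀} {ys} h = record
    { μ = y₀ ∷ μ′ ; decreasing = linked-∷ (≤-pred H.shortens) H.decreasing
    ; inside = inside ; size = size ; on-rim = on-rim ; reach = reach ; shortens = y<x }
    where
    module H = HookRemoval h
    μ′ = H.μ
    x = suc y₀ + d
    ℓ = x ∷ suc y₀ ∷ ys
    μ = y₀ ∷ μ′
    y<x : suc y₀ ≤ x
    y<x = m≤m+n (suc y₀) d
    inside : ∀ c → c ∈D μ → c ∈D ℓ
    inside (suc zero , j)    (a , b , c) = a , b , ≤-trans c (<⇒≤ y<x)
    inside (suc (suc i) , j) p           =
      ∈D-down x (suc y₀ ∷ ys) (H.inside (suc i , j) (∈D-up y₀ μ′ p))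
    size : x + (suc y₀ + sum ys) ≡ (y₀ + sum μ′) + (k′ + suc d)
    size rewrite H.size = arith y₀ d (sum μ′) k′
      where
      arith : ∀ y₀ d S k′ → suc y₀ + d + (S + k′) ≡ y₀ + S + (k′ + suc d)
      arith = solve-∀
    on-rim : ∀ c → Skew ℓ μ c → RimCell ℓ c
    on-rim (suc zero , j) sk with first-row-skew⁻¹ {ℓ} {μ} sk
    ... | _ , y₀<j , _ = proj₁ sk , λ (_ , _ , j<y) → <⇒≱ y₀<j (≤-pred j<y)
    on-rim (suc (suc i) , j) sk =
      rim-down x (suc y₀ ∷ ys) (H.on-rim (suc i , j) (skew-up x (suc y₀ ∷ ys) y₀ μ′ sk))
    -- a lower cell walks (shifted down) to (2 , y₀+1), steps up, and then right
    reach : ∀ c → Skew ℓ μ c → Walk (Skew ℓ μ) c (1 , x)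
    reach (suc zero , j) sk = first-row-reach {ℓ} {μ} sk
    reach (suc (suc i) , j) sk =
      lower ++ʷ step (walk-end lower) (inj₂ (refl , inj₂ refl))
        (first-row-reach {ℓ} {μ} (first-row-skew {ℓ} {μ} (s≤s z≤n) y<x ≤-refl))
      where
      lower : Walk (Skew ℓ μ) (suc (suc i) , j) (2 , suc y₀)
      lower = walk-map shift-down (skew-down x (suc y₀ ∷ ys) y₀ μ′) adjacent-down
                (H.reach (suc i , j) (skew-up x (suc y₀ ∷ ys) y₀ μ′ sk))

  remove-hook : ∀ {k ℓ} → Linked _≥_ ℓ → HookShape k ℓ → HookRemoval k ℓ
  remove-hook lnk (within-row 1≤k k+y≤x) = remove-within-row lnk 1≤k k+y≤x
  remove-hook lnk (down-row {y = zero} h) =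
    ⊥-elim (n≮0 (HookRemoval.shortens (remove-hook (linked-tail lnk) h)))
  remove-hook lnk (down-row {y = suc y₀} h) = extend-down (remove-hook (linked-tail lnk) h)

  -- λ ∖ μ is a rim hook of length t in all respects except that μ need not be
  -- a partition; by definition IsRimHook t λ μ = IsPartition μ × RimHookCells t λ μ.
  RimHookCells : ℕ → List ℕ → List ℕ → Set
  RimHookCells t λs μs = (∀ c → c ∈D μs → c ∈D λs) × (sum λs ≡ sum μs + t)
    × (∀ c → Skew λs μs c → RimCell λs c) × Connected (Skew λs μs)

  hook-removal-cells : ∀ {k ℓ} (h : HookRemoval k ℓ) → RimHookCells k ℓ (HookRemoval.μ h)
  hook-removal-cells h = inside , size , on-rim , reach⇒connected reach
    where open HookRemoval h

  rim-hook-cells-∷ : ∀ {t} x ℓ μ → RimHookCells t ℓ μ → RimHookCells t (x ∷ ℓ) (x ∷ μ)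
  rim-hook-cells-∷ {t} x ℓ μ (inside′ , size′ , on-rim′ , connected′) =
    inside , size , on-rim , connected
    where
    inside : ∀ c → c ∈D (x ∷ μ) → c ∈D (x ∷ ℓ)
    inside (suc zero , j)    p = p
    inside (suc (suc i) , j) p = ∈D-down x ℓ (inside′ (suc i , j) (∈D-up x μ p))
    size : x + sum ℓ ≡ (x + sum μ) + t
    size rewrite size′ = sym (+-assoc x (sum μ) t)
    on-rim : ∀ c → Skew (x ∷ ℓ) (x ∷ μ) c → RimCell (x ∷ ℓ) c
    on-rim (suc zero , j)    (a , ∉μ) = ⊥-elim (∉μ a)
    on-rim (suc (suc i) , j) sk       = rim-down x ℓ (on-rim′ (suc i , j) (skew-up x ℓ x μ sk))
    connected : Connected (Skew (x ∷ ℓ) (x ∷ μ))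
    connected (suc zero , _)    _                 (a , ∉μ) _        = ⊥-elim (∉μ a)
    connected (suc (suc _) , _) (suc zero , _)    _        (a , ∉μ) = ⊥-elim (∉μ a)
    connected (suc (suc i) , j) (suc (suc i′) , j′) sa sb =
      walk-map shift-down (skew-down x ℓ x μ) adjacent-down
        (connected′ (suc i , j) (suc i′ , j′) (skew-up x ℓ x μ sa) (skew-up x ℓ x μ sb))

-- Lists of row lengths describing the same diagram: rim-hook data only
-- depend on the row lengths and the sizes, so they survive padding with
-- empty rows and dropping zero parts.
module SameDiagram where

  open import Defs
  open Walks using (walk-map)
  open RimHooks using (RimHookCells; linked-tail)
  open import Data.Nat using (ℕ; zero; suc; _+_; _∸_; _≤_; _<_; _≥_; z≤n; s≤s)
  open import Data.Nat.Properties using (m+[n∸m]≡n)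
  open import Data.Nat.ListAction using (sum)
  open import Data.List using (List; []; _∷_; _++_; replicate; length)
  open import Data.List.Properties using (length-++; length-replicate)
  open import Data.List.Relation.Unary.Linked using (Linked; []; [-]; _∷_)
  open import Data.List.Relation.Unary.All using (All; []; _∷_)
  open import Data.Product using (_,_)
  open import Relation.Binary.PropositionalEquality

  record SameRows (a b : List ℕ) : Set where
    constructor same-rows
    field row-eq : ∀ i → part a i ≡ part b i

  same-rows-sym : ∀ {a b} → SameRows a b → SameRows b a
  same-rows-sym (same-rows e) = same-rows λ i → sym (e i)

  ∈D-transfer : ∀ {a b} → SameRows a b → ∀ c → c ∈D a → c ∈D b
  ∈D-transfer (same-rows e) (i , j) (p , q , r) = p , q , subst (j ≤_) (e i) r

  rim-hook-cells-transfer : ∀ {t λs λs′ μs μs′} → SameRows λs λs′ → SameRows μs μs′ →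
    sum λs ≡ sum λs′ → sum μs ≡ sum μs′ → RimHookCells t λs μs → RimHookCells t λs′ μs′
  rim-hook-cells-transfer {t} {λs} {λs′} {μs} {μs′} eλ eμ sλ sμ (inside , size , on-rim , connected) =
    (λ c p → ∈D-transfer eλ c (inside c (∈D-transfer eμ⁻¹ c p))) ,
    trans (sym sλ) (trans size (cong (_+ t) sμ)) ,
    (λ c sk → rim-to c (on-rim c (skew-from c sk))) ,
    (λ a b sa sb → walk-map (λ c → c) skew-to (λ _ _ adj → adj)
       (connected a b (skew-from a sa) (skew-from b sb)))
    where
    eλ⁻¹ = same-rows-sym eλ
    eμ⁻¹ = same-rows-sym eμ
    skew-to : ∀ c → Skew λs μs c → Skew λs′ μs′ c
    skew-to c (p , ∉μ) = ∈D-transfer eλ c p , λ q → ∉μ (∈D-transfer eμ⁻¹ c q)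
    skew-from : ∀ c → Skew λs′ μs′ c → Skew λs μs c
    skew-from c (p , ∉μ) = ∈D-transfer eλ⁻¹ c p , λ q → ∉μ (∈D-transfer eμ c q)
    rim-to : ∀ c → RimCell λs c → RimCell λs′ c
    rim-to (i , j) (p , nd) = ∈D-transfer eλ (i , j) p , λ q → nd (∈D-transfer eλ⁻¹ _ q)

  zeros-rows : ∀ xs → Linked _≥_ (0 ∷ xs) → ∀ i → part (0 ∷ xs) i ≡ 0
  zeros-rows xs       _          zero          = refl
  zeros-rows xs       _          (suc zero)    = refl
  zeros-rows []       _          (suc (suc i)) = refl
  zeros-rows (y ∷ ys) (z≤n ∷ l) (suc (suc i)) = zeros-rows ys l (suc i)

  zeros-sum : ∀ xs → Linked _≥_ (0 ∷ xs) → sum (0 ∷ xs) ≡ 0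
  zeros-sum []       _          = refl
  zeros-sum (y ∷ ys) (z≤n ∷ l) = zeros-sum ys l

  drop-zeros : List ℕ → List ℕ
  drop-zeros []           = []
  drop-zeros (zero ∷ _)   = []
  drop-zeros (suc x ∷ xs) = suc x ∷ drop-zeros xs

  drop-zeros-rows : ∀ xs → Linked _≥_ xs → SameRows (drop-zeros xs) xs
  drop-zeros-rows xs l = same-rows (rows xs l)
    where
    rows : ∀ xs → Linked _≥_ xs → ∀ i → part (drop-zeros xs) i ≡ part xs i
    rows []           _ i             = refl
    rows (zero ∷ xs)  l i             = sym (zeros-rows xs l i)
    rows (suc x ∷ xs) l zero          = refl
    rows (suc x ∷ xs) l (suc zero)    = refl
    rows (suc x ∷ xs) l (suc (suc i)) = rows xs (linked-tail l) (suc i)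

  drop-zeros-sum : ∀ xs → Linked _≥_ xs → sum (drop-zeros xs) ≡ sum xs
  drop-zeros-sum []           _ = refl
  drop-zeros-sum (zero ∷ xs)  l = sym (zeros-sum xs l)
  drop-zeros-sum (suc x ∷ xs) l = cong (suc x +_) (drop-zeros-sum xs (linked-tail l))

  drop-zeros-partition : ∀ xs → Linked _≥_ xs → IsPartition (drop-zeros xs)
  drop-zeros-partition xs l = positive xs , decreasing xs l
    where
    positive : ∀ xs → All (0 <_) (drop-zeros xs)
    positive []           = []
    positive (zero ∷ xs)  = []
    positive (suc x ∷ xs) = s≤s z≤n ∷ positive xs
    decreasing : ∀ xs → Linked _≥_ xs → Linked _≥_ (drop-zeros xs)
    decreasing []                   _       = []
    decreasing (zero ∷ xs)          _       = []
    decreasing (suc x ∷ [])         _       = [-]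
    decreasing (suc x ∷ zero ∷ ys)  _       = [-]
    decreasing (suc x ∷ suc y ∷ ys) (r ∷ l) = r ∷ decreasing (suc y ∷ ys) l

  pad : List ℕ → ℕ → List ℕ
  pad xs n = xs ++ replicate n 0

  pad-rows : ∀ xs n → SameRows (pad xs n) xs
  pad-rows xs n = same-rows (rows xs)
    where
    rows : ∀ xs i → part (pad xs n) i ≡ part xs i
    rows []       i             = empty n i
      where
      empty : ∀ n i → part (replicate n 0) i ≡ 0
      empty zero    i             = refl
      empty (suc n) zero          = refl
      empty (suc n) (suc zero)    = refl
      empty (suc n) (suc (suc i)) = empty n (suc i)
    rows (x ∷ xs) zero          = refl
    rows (x ∷ xs) (suc zero)    = refl
    rows (x ∷ xs) (suc (suc i)) = rows xs (suc i)

  pad-sum : ∀ xs n → sum (pad xs n) ≡ sum xs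
  pad-sum []       zero    = refl
  pad-sum []       (suc n) = pad-sum [] n
  pad-sum (x ∷ xs) n       = cong (x +_) (pad-sum xs n)

  pad-length : ∀ xs {N} → length xs ≤ N → length (pad xs (N ∸ length xs)) ≡ N
  pad-length xs {N} L≤N = begin
    length (xs ++ replicate (N ∸ L) 0)   ≡⟨ length-++ xs ⟩
    L + length (replicate (N ∸ L) 0)     ≡⟨ cong (L +_) (length-replicate (N ∸ L)) ⟩
    L + (N ∸ L)                          ≡⟨ m+[n∸m]≡n L≤N ⟩
    N                                    ∎
    where
    open ≡-Reasoning
    L = length xs

  pad-linked : ∀ xs n → Linked _≥_ xs → Linked _≥_ (pad xs n)
  pad-linked []           zero          _       = []
  pad-linked []           (suc zero)    _       = [-]
  pad-linked []           (suc (suc n)) _       = z≤n ∷ pad-linked [] (suc n) []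
  pad-linked (x ∷ [])     zero          _       = [-]
  pad-linked (x ∷ [])     (suc n)       _       = z≤n ∷ pad-linked [] (suc n) []
  pad-linked (x ∷ y ∷ ys) n             (r ∷ l) = r ∷ pad-linked (y ∷ ys) n l

module BetaNumbers where

  open import Defs
  open RimHooks
  open SameDiagram
  open import Data.Nat using (ℕ; zero; suc; _+_; _∸_; _≤_; _<_; _>_; _≥_; z≤n; s≤s; _≤?_)
  open import Data.Nat.Properties
  open import Data.List using (List; []; _∷_; length)
  open import Data.List.Relation.Unary.Linked using (Linked; []; _∷_)
  open import Data.List.Relation.Unary.All as All using (All; []; _∷_)
  open import Data.List.Relation.Unary.AllPairs using (AllPairs; []; _∷_)
  open import Data.List.Relation.Unary.Any using (here; there)
  open import Data.List.Membership.Propositional using (_∈_)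
  open import Data.Product using (_×_; Σ; _,_; proj₂)
  open import Data.Sum using (_⊎_; inj₁; inj₂)
  open import Data.Empty using (⊥-elim)
  open import Relation.Nullary using (¬_; yes; no)
  open import Relation.Binary.PropositionalEquality
  open import Relation.Binary.Definitions using (tri<; tri≈; tri>)
  open import Data.Nat.Tactic.RingSolver using (solve-∀)

  -- The beta-numbers (first-column hook lengths) x_i + (number of later rows)
  -- of a list of rows; for a decreasing list they are strictly decreasing.
  beta : List ℕ → List ℕ
  beta []       = []
  beta (x ∷ xs) = x + length xs ∷ beta xs

  beta-bounded : ∀ y ys → Linked _≥_ (y ∷ ys) → All (_≤ y + length ys) (beta (y ∷ ys))
  beta-bounded y []       _       = ≤-refl ∷ []
  beta-bounded y (z ∷ zs) (z≤y ∷ l) =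
    ≤-refl ∷ All.map (λ b≤ → ≤-trans b≤ shifted) (beta-bounded z zs l)
    where
    shifted : z + length zs ≤ y + suc (length zs)
    shifted = ≤-trans (+-monoˡ-≤ (length zs) z≤y) (+-monoʳ-≤ y (n≤1+n (length zs)))

  beta-decreasing : ∀ ℓ → Linked _≥_ ℓ → AllPairs _>_ (beta ℓ)
  beta-decreasing []           _         = []
  beta-decreasing (x ∷ [])     _         = [] ∷ []
  beta-decreasing (x ∷ y ∷ ys) (y≤x ∷ l) =
    All.map (λ b≤ → ≤-<-trans b≤ below) (beta-bounded y ys l) ∷ beta-decreasing (y ∷ ys) l
    where
    below : y + length ys < x + suc (length ys)
    below = subst (y + length ys <_) (sym (+-suc x (length ys)))
              (s≤s (+-monoˡ-≤ (length ys) y≤x))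

  -- The first bead x + |rest| cannot be moved k positions down: either there
  -- is no room, or the target position is occupied.
  Blocked : ℕ → ℕ → List ℕ → Set
  Blocked k x rest = (x + length rest < k) ⊎ (x + length rest ∸ k ∈ beta (x ∷ rest))

  -- A first row y + d over a row y: its bead sits d + 1 above the next one.
  shuffle : ∀ y d L → y + d + suc L ≡ suc d + (y + L)
  shuffle = solve-∀

  excess-positive : ∀ m e → m < m + e → 1 ≤ e
  excess-positive m e m<m+e = +-cancelˡ-< m 0 e (subst (_< m + e) (sym (+-identityʳ m)) m<m+e)

  hook-or-blocked : ∀ k x rest → Linked _≥_ (x ∷ rest) → 1 ≤ k →
    HookShape k (x ∷ rest) ⊎ Blocked k x rest
  hook-or-blocked k x [] _ 1≤k with k ≤? x
  ... | yes k≤x = inj₁ (within-row 1≤k (subst (_≤ x) (sym (+-identityʳ k)) k≤x))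
  ... | no  k≰x = inj₂ (inj₁ (subst (_< k) (sym (+-identityʳ x)) (≰⇒> k≰x)))
  hook-or-blocked k x (y ∷ ys) (y≤x ∷ l) 1≤k with m≤n⇒∃[o]m+o≡n y≤x
  ... | d , refl with <-cmp k (suc d)
  ... | tri< k<1+d _ _ =
    inj₁ (within-row 1≤k (subst (k + y ≤_) (+-comm d y) (+-monoˡ-≤ y (≤-pred k<1+d))))
  ... | tri≈ _ refl _ =
    inj₂ (inj₂ (there (here (trans (cong (_∸ suc d) (shuffle y d L)) (m+n∸m≡n (suc d) (y + L))))))
    where L = length ys
  ... | tri> _ _ d<k with m≤n⇒∃[o]m+o≡n (<⇒≤ d<k)
  ...   | e , refl with hook-or-blocked e y ys l (excess-positive (suc d) e d<k)
  ...     | inj₁ h = inj₁ (subst (λ k → HookShape k (y + d ∷ y ∷ ys)) (+-comm e (suc d)) (down-row h))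
  ...     | inj₂ (inj₁ no-room) =
    inj₂ (inj₁ (subst (_< suc d + e) (sym (shuffle y d (length ys))) (+-monoʳ-< (suc d) no-room)))
  ...     | inj₂ (inj₂ occupied) =
    inj₂ (inj₂ (there (subst (_∈ beta (y ∷ ys)) moved occupied)))
    where
    L = length ys
    moved : y + L ∸ e ≡ y + d + suc L ∸ (suc d + e)
    moved = sym (trans (cong (_∸ (suc d + e)) (shuffle y d L)) ([m+n]∸[m+o]≡n∸o (suc d) (y + L) e))

  ShiftClosed : ℕ → List ℕ → Set
  ShiftClosed t P = ∀ p → p ∈ P → t ≤ p → p ∸ t ∈ P

  NoRimHook : ℕ → List ℕ → Set
  NoRimHook t ℓ = ¬ Σ (List ℕ) (λ μ → Linked _≥_ μ × RimHookCells t ℓ μ)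

  first-row-bound : ∀ {t ℓ μ} → RimHookCells t ℓ μ → part μ 1 ≤ part ℓ 1
  first-row-bound {μ = []}        _            = z≤n
  first-row-bound {μ = zero ∷ _}  _            = z≤n
  first-row-bound {μ = suc m ∷ _} (inside , _) =
    proj₂ (proj₂ (inside (1 , suc m) (s≤s z≤n , s≤s z≤n , ≤-refl)))

  no-rim-hook-tail : ∀ t x rest → Linked _≥_ (x ∷ rest) → NoRimHook t (x ∷ rest) → NoRimHook t rest
  no-rim-hook-tail t x rest lnk none (μ , μ-decr , hook) =
    none (x ∷ μ , linked-∷ (≤-trans (first-row-bound {t} {rest} {μ} hook) (second≤first lnk)) μ-decr ,
          rim-hook-cells-∷ x rest μ hook)
    where
    second≤first : ∀ {x rest} → Linked _≥_ (x ∷ rest) → part rest 1 ≤ x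
    second≤first {rest = []}    _       = z≤n
    second≤first {rest = _ ∷ _} (r ∷ _) = r

  no-rim-hook⇒shift-closed : ∀ t ℓ → 1 ≤ t → Linked _≥_ ℓ → NoRimHook t ℓ → ShiftClosed t (beta ℓ)
  no-rim-hook⇒shift-closed t (x ∷ rest) 1≤t lnk none p (here refl) t≤p
    with hook-or-blocked t x rest lnk 1≤t
  ... | inj₁ shape = ⊥-elim (none (R.μ , R.decreasing , hook-removal-cells removal))
    where
    removal = remove-hook lnk shape
    module R = HookRemoval removal
  ... | inj₂ (inj₁ no-room)  = ⊥-elim (<⇒≱ no-room t≤p)
  ... | inj₂ (inj₂ occupied) = occupied
  no-rim-hook⇒shift-closed t (x ∷ rest) 1≤t lnk none p (there p∈) t≤p =
    there (no-rim-hook⇒shift-closed t rest 1≤t (linked-tail lnk) (no-rim-hook-tail t x rest lnk none) p p∈ t≤p)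

  core⇒shift-closed : ∀ t π n → 1 ≤ t → IsPartition π → IsCore t π → ShiftClosed t (beta (pad π n))
  core⇒shift-closed t π n 1≤t (_ , π-decr) core =
    no-rim-hook⇒shift-closed t (pad π n) 1≤t (pad-linked π n π-decr) none
    where
    none : NoRimHook t (pad π n)
    none (μ , μ-decr , hook) =
      core (drop-zeros μ , drop-zeros-partition μ μ-decr ,
            rim-hook-cells-transfer (pad-rows π n) (same-rows-sym (drop-zeros-rows μ μ-decr))
              (pad-sum π n) (sym (drop-zeros-sum μ μ-decr)) hook)

module Integers where

  open import Data.Nat using (suc; _+_; _*_; _<_; NonZero; _%_)
  open import Data.Nat.Properties using (≤-trans; m≤m+n; +-assoc; *-suc)
  open import Data.Nat.DivMod using ([m+kn]%n≡m%n; m<n⇒m%n≡m)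
  open import Data.Integer as ℤ using (+_; -[1+_]; _%ℕ_; _/ℕ_)
  open import Data.Integer.DivMod using (n%ℕd<d; a≡a%ℕn+[a/ℕn]*n)
  import Data.Integer.Properties as ℤP
  import Data.Integer.Tactic.RingSolver as ℤSolver
  open import Relation.Binary.PropositionalEquality

  remainder-unique : ∀ d .{{_ : NonZero d}} r q n → r < d → + n ≡ + r ℤ.+ q ℤ.* + d → n % d ≡ r
  remainder-unique d r (+ m) n r<d eq = begin
    n % d           ≡⟨ cong (_% d) (ℤP.+-injective (trans eq (cong (λ x → + r ℤ.+ x) (sym (ℤP.pos-* m d))))) ⟩
    (r + m * d) % d ≡⟨ [m+kn]%n≡m%n r m d ⟩
    r % d           ≡⟨ m<n⇒m%n≡m r<d ⟩
    r               ∎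
    where open ≡-Reasoning
  remainder-unique (suc d′) r -[1+ m ] n r<d eq
    with trans (cong ℤ.sign eq) (ℤP.sign-⊖-< (≤-trans r<d (m≤m+n (suc d′) (m * suc d′))))
  ... | ()

  %ℕ-shift : ∀ d .{{_ : NonZero d}} z K n → z ℤ.+ + (K * d) ≡ + n → z %ℕ d ≡ n % d
  %ℕ-shift d z K n eq = sym (remainder-unique d (z %ℕ d) (z /ℕ d ℤ.+ + K) n (n%ℕd<d z d) expand)
    where
    expand : + n ≡ + (z %ℕ d) ℤ.+ (z /ℕ d ℤ.+ + K) ℤ.* + d
    expand = begin
      + n                                               ≡⟨ eq ⟨
      z ℤ.+ + (K * d)                                   ≡⟨ cong₂ ℤ._+_ (a≡a%ℕn+[a/ℕn]*n z d) (ℤP.pos-* K d) ⟩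
      (+ (z %ℕ d) ℤ.+ z /ℕ d ℤ.* + d) ℤ.+ + K ℤ.* + d   ≡⟨ regroup (+ (z %ℕ d)) (z /ℕ d) (+ K) (+ d) ⟩
      + (z %ℕ d) ℤ.+ (z /ℕ d ℤ.+ + K) ℤ.* + d           ∎
      where
      open ≡-Reasoning
      regroup : ∀ r q k d → (r ℤ.+ q ℤ.* d) ℤ.+ k ℤ.* d ≡ r ℤ.+ (q ℤ.+ k) ℤ.* d
      regroup = ℤSolver.solve-∀

  content-shift : ∀ j i o → (+ j ℤ.- + i) ℤ.+ + (i + o) ≡ + (j + o)
  content-shift j i o rewrite ℤP.pos-+ i o | ℤP.pos-+ j o = cancel (+ j) (+ i) (+ o)
    where
    cancel : ∀ J I O → (J ℤ.- I) ℤ.+ (I ℤ.+ O) ≡ J ℤ.+ O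
    cancel = ℤSolver.solve-∀

  content-exponent : ∀ j i o s′ → (+ j ℤ.- + i) ℤ.+ + ((i + o) * suc s′) ≡ + (j + o + (i + o) * s′)
  content-exponent j i o s′ = begin
    (+ j ℤ.- + i) ℤ.+ + ((i + o) * suc s′)      ≡⟨ cong (λ m → (+ j ℤ.- + i) ℤ.+ + m) N·s ⟩
    (+ j ℤ.- + i) ℤ.+ + (i + (o + (i + o) * s′)) ≡⟨ content-shift j i (o + (i + o) * s′) ⟩
    + (j + (o + (i + o) * s′))                    ≡⟨ cong +_ (+-assoc j o _) ⟨
    + (j + o + (i + o) * s′)                      ∎
    where
    open ≡-Reasoning
    N·s : (i + o) * suc s′ ≡ i + (o + (i + o) * s′)
    N·s = trans (*-suc (i + o) s′) (+-assoc i o _)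

  twisted-exponent : ∀ t c L s′ → + t ℤ.* (+ c ℤ.- + L) ℤ.+ + (L * t * suc s′) ≡ + (c * t + L * t * s′)
  twisted-exponent t c L s′ = begin
    + t ℤ.* (+ c ℤ.- + L) ℤ.+ + (L * t * suc s′)
      ≡⟨ cong (λ x → + t ℤ.* (+ c ℤ.- + L) ℤ.+ x) (trans (ℤP.pos-* (L * t) (suc s′)) (cong (ℤ._* + suc s′) (ℤP.pos-* L t))) ⟩
    + t ℤ.* (+ c ℤ.- + L) ℤ.+ + L ℤ.* + t ℤ.* (ℤ.1ℤ ℤ.+ + s′)
      ≡⟨ expand (+ t) (+ c) (+ L) (+ s′) ⟩
    + c ℤ.* + t ℤ.+ + L ℤ.* + t ℤ.* + s′
      ≡⟨ cong₂ ℤ._+_ (ℤP.pos-* c t) (trans (ℤP.pos-* (L * t) s′) (cong (ℤ._* + s′) (ℤP.pos-* L t))) ⟨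
    + (c * t) ℤ.+ + (L * t * s′)
      ≡⟨ ℤP.pos-+ (c * t) (L * t * s′) ⟨
    + (c * t + L * t * s′) ∎
    where
    open ≡-Reasoning
    expand : ∀ T C L S → T ℤ.* (C ℤ.- L) ℤ.+ L ℤ.* T ℤ.* (ℤ.1ℤ ℤ.+ S) ≡ C ℤ.* T ℤ.+ L ℤ.* T ℤ.* S
    expand = ℤSolver.solve-∀

  difference-swap : ∀ a b c v → a + v ≡ b + c → ℤ.+ a ℤ.- ℤ.+ b ≡ ℤ.+ c ℤ.- ℤ.+ v
  difference-swap a b c v e = begin
    ℤ.+ a ℤ.- ℤ.+ b                             ≡⟨ shift-both (ℤ.+ a) (ℤ.+ b) (ℤ.+ v) ⟩
    (ℤ.+ a ℤ.+ ℤ.+ v) ℤ.- (ℤ.+ b ℤ.+ ℤ.+ v)     ≡⟨ cong₂ ℤ._-_ (sym (ℤP.pos-+ a v)) (sym (ℤP.pos-+ b v)) ⟩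
    ℤ.+ (a + v) ℤ.- (ℤ.+ b ℤ.+ ℤ.+ v)           ≡⟨ cong (λ x → ℤ.+ x ℤ.- (ℤ.+ b ℤ.+ ℤ.+ v)) e ⟩
    ℤ.+ (b + c) ℤ.- (ℤ.+ b ℤ.+ ℤ.+ v)           ≡⟨ cong (ℤ._- (ℤ.+ b ℤ.+ ℤ.+ v)) (ℤP.pos-+ b c) ⟩
    (ℤ.+ b ℤ.+ ℤ.+ c) ℤ.- (ℤ.+ b ℤ.+ ℤ.+ v)     ≡⟨ cancel (ℤ.+ b) (ℤ.+ c) (ℤ.+ v) ⟩
    ℤ.+ c ℤ.- ℤ.+ v                             ∎
    where
    open ≡-Reasoning
    shift-both : ∀ A B V → A ℤ.- B ≡ (A ℤ.+ V) ℤ.- (B ℤ.+ V)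
    shift-both = ℤSolver.solve-∀
    cancel : ∀ B C V → (B ℤ.+ C) ℤ.- (B ℤ.+ V) ≡ C ℤ.- V
    cancel = ℤSolver.solve-∀

module Counting where

  open import Defs
  open SameDiagram using (pad)
  open BetaNumbers using (ShiftClosed)
  open import Data.Nat as ℕ using (ℕ; zero; suc; _+_; _>_)
  open import Data.Nat.Properties using (_≟_; ≤-<-trans; m∸n≤m)
  open import Data.List using (List; []; _∷_; downFrom)
  import Data.List.Relation.Unary.All as All
  open import Data.List.Relation.Unary.AllPairs using (AllPairs; []; _∷_)
  open import Data.List.Membership.Propositional.Properties using (∈-downFrom⁺; ∈-downFrom⁻)
  open import Data.Bool using (if_then_else_)
  open import Relation.Nullary using (¬_; yes; no; does)
  open import Relation.Nullary.Decidable using (dec-true; dec-false)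
  open import Relation.Binary.PropositionalEquality

  δ : ℕ → ℕ → ℕ
  δ a b = if does (a ≟ b) then 1 else 0

  δ-≡ : ∀ {a b} → a ≡ b → δ a b ≡ 1
  δ-≡ {a} {b} e = cong (if_then 1 else 0) (dec-true (a ≟ b) e)

  δ-≢ : ∀ {a b} → ¬ a ≡ b → δ a b ≡ 0
  δ-≢ {a} {b} ne = cong (if_then 1 else 0) (dec-false (a ≟ b) ne)

  δ-⇔ : ∀ {a b c d} → (a ≡ b → c ≡ d) → (c ≡ d → a ≡ b) → δ a b ≡ δ c d
  δ-⇔ {a} {b} f g with a ≟ b
  ... | yes p = trans (δ-≡ p) (sym (δ-≡ (f p)))
  ... | no ¬p = trans (δ-≢ ¬p) (sym (δ-≢ (λ q → ¬p (g q))))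

  rowsCount-pad : ∀ m .{{_ : ℕ.NonZero m}} k i xs n → rowsCount m k i (pad xs n) ≡ rowsCount m k i xs
  rowsCount-pad m k i []       zero    = refl
  rowsCount-pad m k i []       (suc n) = rowsCount-pad m k (suc i) [] n
  rowsCount-pad m k i (x ∷ xs) n       = cong (rowCount m k i x +_) (rowsCount-pad m k (suc i) xs n)

  -- Row offsets: the rows of a list of length n have offsets n-1, …, 0.
  downFrom-decreasing : ∀ n → AllPairs _>_ (downFrom n)
  downFrom-decreasing zero    = []
  downFrom-decreasing (suc n) = All.tabulate ∈-downFrom⁻ ∷ downFrom-decreasing n

  downFrom-shift-closed : ∀ t n → ShiftClosed t (downFrom n)
  downFrom-shift-closed t n q q∈ _ = ∈-downFrom⁺ (≤-<-trans (m∸n≤m q t) (∈-downFrom⁻ q∈))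

-- Bead bookkeeping on the t-abacus (t = t′ + 1): runner k holds the beads
-- congruent to k modulo t.
module Abacus (t′ : ℕ) where

  open import Defs
  open BetaNumbers using (beta; ShiftClosed)
  open Integers using (%ℕ-shift; content-shift; difference-swap)
  open Counting
  open import Data.Nat using (ℕ; zero; suc; _+_; _∸_; _*_; _≤_; _<_; _>_; z≤n; s≤s; _≤?_; _%_; _/_)
  open import Data.Nat.Properties
  open import Data.Nat.DivMod
  open import Data.Nat.Divisibility using (n∣m*n)
  open import Data.Integer as ℤ using (_%ℕ_)
  open import Data.List using (List; []; _∷_; length; downFrom)
  open import Data.List.Relation.Unary.All as All using (All; []; _∷_)
  open import Data.List.Relation.Unary.AllPairs using (AllPairs; _∷_; head; tail)
  open import Data.List.Membership.Propositional.Properties using (∈-downFrom⁺; ∈-downFrom⁻)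
  open import Data.List.Relation.Unary.Any using (here; there)
  open import Data.List.Membership.Propositional using (_∈_)
  open import Data.Empty using (⊥-elim)
  open import Relation.Nullary using (¬_; yes; no)
  open import Relation.Binary.PropositionalEquality
  open import Data.Nat.Tactic.RingSolver using (solve-∀)

  t : ℕ
  t = suc t′

  runner-count : ℕ → List ℕ → ℕ
  runner-count k []       = 0
  runner-count k (p ∷ ps) = δ (p % t) k + runner-count k ps

  δ-suc : ∀ n k → k < t → δ (suc n % t) (suc k % t) ≡ δ (n % t) k
  δ-suc n k k<t = δ-⇔ cancel (λ e → shift-suc (trans e (sym (m<n⇒m%n≡m k<t))))
    where
    shift : ∀ c {a b} → a % t ≡ b % t → (c + a) % t ≡ (c + b) % t
    shift c {a} {b} e = begin
      (c + a) % t         ≡⟨ %-distribˡ-+ c a t ⟩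
      (c % t + a % t) % t ≡⟨ cong (λ x → (c % t + x) % t) e ⟩
      (c % t + b % t) % t ≡⟨ %-distribˡ-+ c b t ⟨
      (c + b) % t         ∎
      where open ≡-Reasoning
    shift-suc : ∀ {a b} → a % t ≡ b % t → suc a % t ≡ suc b % t
    shift-suc = shift 1
    unshift : ∀ a → (t′ + suc a) % t ≡ a % t
    unshift a = trans (cong (_% t) (trans (+-suc t′ a) (+-comm t a))) ([m+n]%n≡m%n a t)
    cancel : suc n % t ≡ suc k % t → n % t ≡ k
    cancel e = begin
      n % t            ≡⟨ unshift n ⟨
      (t′ + suc n) % t ≡⟨ shift t′ e ⟩
      (t′ + suc k) % t ≡⟨ unshift k ⟩
      k % t            ≡⟨ m<n⇒m%n≡m k<t ⟩
      k                ∎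
      where open ≡-Reasoning

  -- Padded to N = L·t rows, row i has offset o = N - i; the content j - i of
  -- its cell (i , j) is congruent to j + o modulo t.
  content-residue : ∀ L j i o → i + o ≡ L * t → (ℤ.+ j ℤ.- ℤ.+ i) %ℕ t ≡ (j + o) % t
  content-residue L j i o e =
    %ℕ-shift t (ℤ.+ j ℤ.- ℤ.+ i) L (j + o)
      (subst (λ n → (ℤ.+ j ℤ.- ℤ.+ i) ℤ.+ ℤ.+ n ≡ ℤ.+ (j + o)) e (content-shift j i o))

  -- In a row of length l with offset o, the cells of content ≡ k + 1 are
  -- those of content ≡ k shifted by one column: the counts differ by the
  -- window ends, [o ≡ k] and [l + o ≡ k].
  row-telescope : ∀ L k → k < t → ∀ i o l → i + o ≡ L * t →
    rowCount t k i l + δ (o % t) k ≡ rowCount t (suc k % t) i l + δ ((l + o) % t) k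
  row-telescope L k k<t i o zero    e = refl
  row-telescope L k k<t i o (suc l) e
    rewrite content-residue L (suc l) i o e | δ-suc (l + o) k k<t =
    regroup (δ ((suc l + o) % t) k) (rowCount t k i l) (δ (o % t) k)
            (rowCount t (suc k % t) i l) (δ ((l + o) % t) k) (row-telescope L k k<t i o l e)
    where
    regroup : ∀ a r d r′ b → r + d ≡ r′ + b → a + r + d ≡ b + r′ + a
    regroup a r d r′ b h = begin
      a + r + d    ≡⟨ +-assoc a r d ⟩
      a + (r + d)  ≡⟨ cong (a +_) h ⟩
      a + (r′ + b) ≡⟨ +-comm a (r′ + b) ⟩
      r′ + b + a   ≡⟨ cong (_+ a) (+-comm r′ b) ⟩
      b + r′ + a   ∎
      where open ≡-Reasoning

  -- Summed over the rows of ℓ (offsets length ℓ - 1, …, 0 from the top), the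
  -- window starts are the offsets downFrom (length ℓ) and the window ends are
  -- the beta-numbers of ℓ.
  rows-telescope : ∀ L k → k < t → ∀ i ℓ → i + length ℓ ≡ suc (L * t) →
    rowsCount t k i ℓ + runner-count k (downFrom (length ℓ))
      ≡ rowsCount t (suc k % t) i ℓ + runner-count k (beta ℓ)
  rows-telescope L k k<t i []       e = refl
  rows-telescope L k k<t i (x ∷ xs) e =
    interchange (rowCount t k i x) (rowsCount t k (suc i) xs)
      (δ (length xs % t) k) (runner-count k (downFrom (length xs)))
      (rowCount t (suc k % t) i x) (rowsCount t (suc k % t) (suc i) xs)
      (δ ((x + length xs) % t) k) (runner-count k (beta xs))
      (row-telescope L k k<t i (length xs) x e′)
      (rows-telescope L k k<t (suc i) xs (cong suc e′))
    where
    e′ : i + length xs ≡ L * t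
    e′ = suc-injective (trans (sym (+-suc i (length xs))) e)
    interchange : ∀ a b c d a′ b′ c′ d′ → a + c ≡ a′ + c′ → b + d ≡ b′ + d′ →
      (a + b) + (c + d) ≡ (a′ + b′) + (c′ + d′)
    interchange a b c d a′ b′ c′ d′ h₁ h₂ = begin
      (a + b) + (c + d)     ≡⟨ middle-swap a b c d ⟩
      (a + c) + (b + d)     ≡⟨ cong₂ _+_ h₁ h₂ ⟩
      (a′ + c′) + (b′ + d′) ≡⟨ middle-swap a′ c′ b′ d′ ⟩
      (a′ + b′) + (c′ + d′) ∎
      where
      open ≡-Reasoning
      middle-swap : ∀ a b c d → (a + b) + (c + d) ≡ (a + c) + (b + d)
      middle-swap = solve-∀

  shift-moves : ∀ {q} → t ≤ q → ¬ q ∸ t ≡ q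
  shift-moves t≤q = <⇒≢ (∸-monoʳ-< (s≤s z≤n) t≤q)

  head-shift : ∀ {q Q} → ShiftClosed t (q ∷ Q) → t ≤ q → q ∸ t ∈ Q
  head-shift closed t≤q with closed _ (here refl) t≤q
  ... | here q∸t≡q = ⊥-elim (shift-moves t≤q q∸t≡q)
  ... | there q∸t∈Q = q∸t∈Q

  -- The tail of a strictly decreasing shift-closed list is shift-closed,
  -- since shifts move beads down.
  tail-shift-closed : ∀ {q Q} → AllPairs _>_ (q ∷ Q) → ShiftClosed t (q ∷ Q) → ShiftClosed t Q
  tail-shift-closed (q>Q ∷ _) closed r r∈Q t≤r with closed r (there r∈Q) t≤r
  ... | here r∸t≡q  = ⊥-elim (<⇒≱ (All.lookup q>Q r∈Q) (≤-trans (≤-reflexive (sym r∸t≡q)) (m∸n≤m r t)))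
  ... | there r∸t∈Q = r∸t∈Q

  same-runner-gap : ∀ q p → q % t ≡ p % t → q < p → q + t ≤ p
  same-runner-gap q p same q<p = begin
    q + t                         ≡⟨ cong (_+ t) q≡ ⟩
    p % t + q / t * t + t         ≡⟨ +-assoc (p % t) (q / t * t) t ⟩
    p % t + (q / t * t + t)       ≡⟨ cong (p % t +_) (+-comm (q / t * t) t) ⟩
    p % t + suc (q / t) * t       ≤⟨ +-monoʳ-≤ (p % t) (*-monoˡ-≤ t q/t<p/t) ⟩
    p % t + p / t * t             ≡⟨ m≡m%n+[m/n]*n p t ⟨
    p                             ∎
    where
    open ≤-Reasoning
    q≡ : q ≡ p % t + q / t * t
    q≡ = trans (m≡m%n+[m/n]*n q t) (cong (_+ q / t * t) same)
    q/t<p/t : q / t < p / t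
    q/t<p/t = *-cancelʳ-< t (q / t) (p / t)
      (+-cancelˡ-< (p % t) _ _ (subst₂ _<_ q≡ (m≡m%n+[m/n]*n p t) q<p))

  runner-count-below : ∀ Q p → AllPairs _>_ Q → ShiftClosed t Q → All (_< p) Q →
    (t ≤ p → p ∸ t ∈ Q) → runner-count (p % t) Q ≡ p / t
  runner-count-below [] p _ _ _ below with t ≤? p
  ... | yes t≤p with below t≤p
  ...   | ()
  runner-count-below [] p _ _ _ below | no t≰p = sym (m<n⇒m/n≡0 (≰⇒> t≰p))
  runner-count-below (q ∷ Q) p decr closed (q<p ∷ Q<p) below with q % t ≟ p % t
  ... | yes same = begin
    δ (q % t) (p % t) + runner-count (p % t) Q ≡⟨ cong₂ _+_ (δ-≡ same) (cong (λ k → runner-count k Q) (sym same)) ⟩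
    1 + runner-count (q % t) Q
      ≡⟨ cong suc (runner-count-below Q q (tail decr) closed′ (head decr) (head-shift closed)) ⟩
    1 + q / t                                  ≡⟨ cong (λ x → 1 + x / t) (sym p∸t≡q) ⟩
    1 + (p ∸ t) / t                            ≡⟨ m/n≡1+[m∸n]/n t≤p ⟨
    p / t                                      ∎
    where
    open ≡-Reasoning
    closed′ = tail-shift-closed decr closed
    gap = same-runner-gap q p same q<p
    t≤p : t ≤ p
    t≤p = ≤-trans (m≤n+m t q) gap
    -- p ∸ t is a bead of q ∷ Q at or above q, hence equal to q
    p∸t≡q : p ∸ t ≡ q
    p∸t≡q with below t≤p
    ... | here e = e
    ... | there p∸t∈Q = ⊥-elim (<⇒≱ (All.lookup (head decr) p∸t∈Q)
                          (≤-trans (≤-reflexive (sym (m+n∸n≡m q t))) (∸-monoˡ-≤ t gap)))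
  ... | no other = begin
    δ (q % t) (p % t) + runner-count (p % t) Q ≡⟨ cong (_+ runner-count (p % t) Q) (δ-≢ other) ⟩
    runner-count (p % t) Q                     ≡⟨ runner-count-below Q p (tail decr) (tail-shift-closed decr closed) Q<p below′ ⟩
    p / t                                      ∎
    where
    open ≡-Reasoning
    -- p ∸ t is on the runner of p, so it is not q
    below′ : t ≤ p → p ∸ t ∈ Q
    below′ t≤p with below t≤p
    ... | here p∸t≡q = ⊥-elim (other (trans (cong (_% t) (sym p∸t≡q)) (m≤n⇒[n∸m]%m≡n%m t≤p)))
    ... | there p∸t∈Q = p∸t∈Q

  shifted-below : ∀ L k → k < t → t ≤ k + L * t → k + L * t ∸ t < L * t
  shifted-below L k k<t t≤p = +-cancelʳ-< t (k + L * t ∸ t) (L * t) (begin-strict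
    k + L * t ∸ t + t ≡⟨ m∸n+n≡m t≤p ⟩
    k + L * t         ≡⟨ +-comm k (L * t) ⟩
    L * t + k         <⟨ +-monoʳ-< (L * t) k<t ⟩
    L * t + t         ∎)
    where open ≤-Reasoning

  runner-count-downFrom : ∀ L k → k < t → runner-count k (downFrom (L * t)) ≡ L
  runner-count-downFrom L k k<t = begin
    runner-count k (downFrom (L * t))       ≡⟨ cong (λ x → runner-count x (downFrom (L * t))) p%t ⟨
    runner-count (p % t) (downFrom (L * t)) ≡⟨ runner-count-below (downFrom (L * t)) p (downFrom-decreasing (L * t))
                                                 (downFrom-shift-closed t (L * t)) (All.tabulate (λ q∈ → <-≤-trans (∈-downFrom⁻ q∈) (m≤n+m (L * t) k)))
                                                 (λ t≤p → ∈-downFrom⁺ (shifted-below L k k<t t≤p)) ⟩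
    p / t                                   ≡⟨ p/t ⟩
    L                                       ∎
    where
    open ≡-Reasoning
    p = k + L * t
    p%t : p % t ≡ k
    p%t = trans ([m+kn]%n≡m%n k L t) (m<n⇒m%n≡m k<t)
    p/t : p / t ≡ L
    p/t = trans (+-distrib-/-∣ʳ k (n∣m*n L)) (cong₂ _+_ (m<n⇒m/n≡0 k<t) (m*n/n≡m L t))

  n-formula : ∀ L ℓ k → k < t → length ℓ ≡ L * t → nn k ℓ t ≡ ℤ.+ runner-count k (beta ℓ) ℤ.- ℤ.+ L
  n-formula L ℓ k k<t len = begin
    nn k ℓ t
      ≡⟨ difference-swap (r k ℓ t) (r (suc k % t) ℓ t) (runner-count k (beta ℓ)) (runner-count k (downFrom (length ℓ)))
           (rows-telescope L k k<t 1 ℓ (cong suc len)) ⟩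
    ℤ.+ runner-count k (beta ℓ) ℤ.- ℤ.+ runner-count k (downFrom (length ℓ))
      ≡⟨ cong (λ n → ℤ.+ runner-count k (beta ℓ) ℤ.- ℤ.+ runner-count k (downFrom n)) len ⟩
    ℤ.+ runner-count k (beta ℓ) ℤ.- ℤ.+ runner-count k (downFrom (L * t))
      ≡⟨ cong (λ x → ℤ.+ runner-count k (beta ℓ) ℤ.- ℤ.+ x) (runner-count-downFrom L k k<t) ⟩
    ℤ.+ runner-count k (beta ℓ) ℤ.- ℤ.+ L ∎
    where open ≡-Reasoning

module RingSums {r₁ r₂} (R : CommutativeRing r₁ r₂) where

  open CommutativeRing R
  open RingDefs R
  open Counting using (δ; δ-≡; δ-≢)
  open import Algebra.Properties.Ring ring using (-0#≈0#; -‿+-comm)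
  open import Data.Nat as ℕ using (ℕ; zero; suc; _<_)
  import Data.Nat.Properties as ℕP
  open import Relation.Binary.PropositionalEquality as ≡ using (_≡_)
  open import Relation.Nullary using (yes; no)
  open import Relation.Binary.Reasoning.Setoid setoid
  open import Algebra.Solver.Ring.NaturalCoefficients.Default commutativeSemiring

  ≡⇒≈ : ∀ {x y} → x ≡ y → x ≈ y
  ≡⇒≈ ≡.refl = refl

  pow-+ : ∀ x m n → pow x (m ℕ.+ n) ≈ pow x m * pow x n
  pow-+ x zero    n = sym (*-identityˡ _)
  pow-+ x (suc m) n = trans (*-congˡ (pow-+ x m n)) (sym (*-assoc _ _ _))

  pow-multiple : ∀ x s → pow x s ≈ 1# → ∀ n → pow x (n ℕ.* s) ≈ 1#
  pow-multiple x s xˢ≈1 zero    = refl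
  pow-multiple x s xˢ≈1 (suc n) = begin
    pow x (s ℕ.+ n ℕ.* s)       ≈⟨ pow-+ x s (n ℕ.* s) ⟩
    pow x s * pow x (n ℕ.* s)   ≈⟨ *-cong xˢ≈1 (pow-multiple x s xˢ≈1 n) ⟩
    1# * 1#                     ≈⟨ *-identityˡ 1# ⟩
    1#                          ∎

  fromℕ-+ : ∀ m n → fromℕ (m ℕ.+ n) ≈ fromℕ m + fromℕ n
  fromℕ-+ zero    n = sym (+-identityˡ _)
  fromℕ-+ (suc m) n = trans (+-congˡ (fromℕ-+ m n)) (sym (+-assoc _ _ _))

  sumTo-cong : ∀ n {f g : ℕ → Carrier} → (∀ k → k < n → f k ≈ g k) → sumTo n f ≈ sumTo n g
  sumTo-cong zero    f≈g = refl
  sumTo-cong (suc n) f≈g = +-cong (sumTo-cong n (λ k k<n → f≈g k (ℕP.m<n⇒m<1+n k<n))) (f≈g n ℕP.≤-refl)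

  sumTo-+ : ∀ n (f g : ℕ → Carrier) → sumTo n (λ k → f k + g k) ≈ sumTo n f + sumTo n g
  sumTo-+ zero    f g = sym (+-identityˡ _)
  sumTo-+ (suc n) f g = trans (+-congʳ (sumTo-+ n f g)) (interchange _ _ _ _)
    where
    interchange : ∀ a b c d → (a + b) + (c + d) ≈ (a + c) + (b + d)
    interchange = solve 4 (λ a b c d → (a :+ b) :+ (c :+ d) := (a :+ c) :+ (b :+ d)) refl

  sumTo-*ˡ : ∀ n a (f : ℕ → Carrier) → sumTo n (λ k → a * f k) ≈ a * sumTo n f
  sumTo-*ˡ zero    a f = sym (zeroʳ a)
  sumTo-*ˡ (suc n) a f = trans (+-congʳ (sumTo-*ˡ n a f)) (sym (distribˡ _ _ _))

  sumTo-zero : ∀ n → sumTo n (λ _ → 0#) ≈ 0#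
  sumTo-zero zero    = refl
  sumTo-zero (suc n) = trans (+-identityʳ _) (sumTo-zero n)

  sumTo-neg : ∀ n (f : ℕ → Carrier) → sumTo n (λ k → - f k) ≈ - sumTo n f
  sumTo-neg zero    f = sym -0#≈0#
  sumTo-neg (suc n) f = trans (+-congʳ (sumTo-neg n f)) (-‿+-comm _ _)

  sumTo-- : ∀ n (f g : ℕ → Carrier) → sumTo n (λ k → f k - g k) ≈ sumTo n f - sumTo n g
  sumTo-- n f g = trans (sumTo-+ n f (λ k → - g k)) (+-congˡ (sumTo-neg n g))

  sumTo-weighted-+ : ∀ n (a b : ℕ → ℕ) (f : ℕ → Carrier) →
    sumTo n (λ k → fromℕ (a k ℕ.+ b k) * f k) ≈ sumTo n (λ k → fromℕ (a k) * f k) + sumTo n (λ k → fromℕ (b k) * f k)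
  sumTo-weighted-+ n a b f = trans (sumTo-cong n (λ k _ → trans (*-congʳ (fromℕ-+ (a k) (b k))) (distribʳ _ _ _)))
                                   (sumTo-+ n _ _)

  sumTo-weighted-0 : ∀ n (f : ℕ → Carrier) → sumTo n (λ k → 0# * f k) ≈ 0#
  sumTo-weighted-0 n f = trans (sumTo-cong n (λ k _ → zeroˡ (f k))) (sumTo-zero n)

  swap₂₃ : ∀ x y z → (x + y) + z ≈ (x + z) + y
  swap₂₃ = solve 3 (λ x y z → (x :+ y) :+ z := (x :+ z) :+ y) refl

  sumTo-δ-exchange : ∀ n a → a < n → (H : ℕ → ℕ → Carrier) →
    sumTo n (λ k → H k (δ a k)) + H a 0 ≈ sumTo n (λ k → H k 0) + H a 1
  sumTo-δ-exchange zero    a ()  H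
  sumTo-δ-exchange (suc n) a a<1+n H with a ℕP.≟ n
  ... | yes ≡.refl = begin
    (sumTo a (λ k → H k (δ a k)) + H a (δ a a)) + H a 0
      ≈⟨ +-congʳ (+-cong (sumTo-cong a (λ k k<a → ≡⇒≈ (≡.cong (H k) (δ-≢ (λ a≡k → ℕP.<-irrefl (≡.sym a≡k) k<a)))))
                         (≡⇒≈ (≡.cong (H a) (δ-≡ {a} ≡.refl)))) ⟩
    (sumTo a (λ k → H k 0) + H a 1) + H a 0 ≈⟨ swap₂₃ _ _ _ ⟩
    (sumTo a (λ k → H k 0) + H a 0) + H a 1 ∎
  ... | no a≢n = begin
    (sumTo n (λ k → H k (δ a k)) + H n (δ a n)) + H a 0
      ≈⟨ +-congʳ (+-congˡ (≡⇒≈ (≡.cong (H n) (δ-≢ a≢n)))) ⟩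
    (sumTo n (λ k → H k (δ a k)) + H n 0) + H a 0 ≈⟨ swap₂₃ _ _ _ ⟩
    (sumTo n (λ k → H k (δ a k)) + H a 0) + H n 0
      ≈⟨ +-congʳ (sumTo-δ-exchange n a (ℕP.≤∧≢⇒< (ℕP.≤-pred a<1+n) a≢n) H) ⟩
    (sumTo n (λ k → H k 0) + H a 1) + H n 0 ≈⟨ swap₂₃ _ _ _ ⟩
    (sumTo n (λ k → H k 0) + H n 0) + H a 1 ∎

  sumTo-δ : ∀ n a → a < n → (f : ℕ → Carrier) → sumTo n (λ k → fromℕ (δ a k) * f k) ≈ f a
  sumTo-δ n a a<n f = begin
    sumTo n (λ k → fromℕ (δ a k) * f k)             ≈⟨ +-identityʳ _ ⟨
    sumTo n (λ k → fromℕ (δ a k) * f k) + 0#        ≈⟨ +-congˡ (zeroˡ (f a)) ⟨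
    sumTo n (λ k → fromℕ (δ a k) * f k) + 0# * f a  ≈⟨ sumTo-δ-exchange n a a<n (λ k b → fromℕ b * f k) ⟩
    sumTo n (λ k → 0# * f k) + (1# + 0#) * f a       ≈⟨ +-cong (sumTo-weighted-0 n f)
                                                              (trans (*-congʳ (+-identityʳ 1#)) (*-identityˡ (f a))) ⟩
    0# + f a                                         ≈⟨ +-identityˡ (f a) ⟩
    f a                                              ∎

  -- The final elimination: from the four relations between the row sum X,
  -- the bead sums Sβ, So and the runner sums Gβ, Go (U, V the two factors of
  -- the denominator, W a unit-like factor), solve for W·X·U·V.
  eliminate : ∀ w W X U V Sβ So Gβ Go Z →
    U * X + w * Sβ ≈ w * So → V * Sβ + Gβ ≈ Z → V * So + Go ≈ Z → W * Go ≈ Z →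
    (W * X) * (U * V) ≈ (w * W) * Gβ - w * Z
  eliminate w W X U V Sβ So Gβ Go Z rows beads offsets top = x≈z//y _ _ _ (+-cancelʳ C _ _ (begin
    ((W * X) * (U * V) + w * Z) + C           ≈⟨ +-congʳ (+-congˡ (*-congˡ top)) ⟨
    ((W * X) * (U * V) + w * (W * Go)) + C    ≈⟨ regroup₁ W X U V w Go So ⟩
    (W * X) * (U * V) + (w * W) * (V * So + Go) ≈⟨ +-congˡ (*-congˡ (trans offsets (sym beads))) ⟩
    (W * X) * (U * V) + (w * W) * (V * Sβ + Gβ) ≈⟨ regroup₂ W X U V w Sβ Gβ ⟩
    (W * V) * (U * X + w * Sβ) + (w * W) * Gβ ≈⟨ +-congʳ (*-congˡ rows) ⟩
    (W * V) * (w * So) + (w * W) * Gβ         ≈⟨ regroup₃ W V w So Gβ ⟩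
    (w * W) * Gβ + C                          ∎))
    where
    open import Algebra.Properties.Ring ring using (+-cancelʳ; x≈z//y)
    C = ((w * W) * V) * So
    regroup₁ : ∀ W X U V w Go So →
      ((W * X) * (U * V) + w * (W * Go)) + ((w * W) * V) * So ≈ (W * X) * (U * V) + (w * W) * (V * So + Go)
    regroup₁ = solve 7 (λ W X U V w Go So →
      ((W :* X) :* (U :* V) :+ w :* (W :* Go)) :+ ((w :* W) :* V) :* So := (W :* X) :* (U :* V) :+ (w :* W) :* (V :* So :+ Go)) refl
    regroup₂ : ∀ W X U V w Sβ Gβ →
      (W * X) * (U * V) + (w * W) * (V * Sβ + Gβ) ≈ (W * V) * (U * X + w * Sβ) + (w * W) * Gβ
    regroup₂ = solve 7 (λ W X U V w Sβ Gβ →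
      (W :* X) :* (U :* V) :+ (w :* W) :* (V :* Sβ :+ Gβ) := (W :* V) :* (U :* X :+ w :* Sβ) :+ (w :* W) :* Gβ) refl
    regroup₃ : ∀ W V w So Gβ → (W * V) * (w * So) + (w * W) * Gβ ≈ (w * W) * Gβ + ((w * W) * V) * So
    regroup₃ = solve 5 (λ W V w So Gβ → (W :* V) :* (w :* So) :+ (w :* W) :* Gβ := (w :* W) :* Gβ :+ ((w :* W) :* V) :* So) refl

  divide : ∀ x a y d → x * a ≈ y → d * a ≈ 1# → x ≈ y * d
  divide x a y d xa≈y da≈1 = begin
    x             ≈⟨ *-identityʳ x ⟨
    x * 1#        ≈⟨ *-congˡ da≈1 ⟨
    x * (d * a)   ≈⟨ rotate x d a ⟩
    (x * a) * d   ≈⟨ *-congʳ xa≈y ⟩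
    y * d         ∎
    where
    rotate : ∀ x d a → x * (d * a) ≈ (x * a) * d
    rotate = solve 3 (λ x d a → x :* (d :* a) := (x :* a) :* d) refl

module GeometricSums {r₁ r₂} (R : CommutativeRing r₁ r₂) (ω : CommutativeRing.Carrier R) where

  open CommutativeRing R
  open RingDefs R
  open RingSums R
  open BetaNumbers using (beta; ShiftClosed)
  open Counting using (δ)
  open import Data.Nat as ℕ using (ℕ; zero; suc; _>_; _%_; _/_)
  open import Data.Nat.DivMod using (m≡m%n+[m/n]*n; m%n<n)
  open import Data.List using (List; []; _∷_; length; downFrom)
  open import Data.List.Relation.Unary.AllPairs using (AllPairs; _∷_)
  open import Relation.Binary.PropositionalEquality as ≡ using (_≡_)
  open import Relation.Binary.Reasoning.Setoid setoid
  open import Algebra.Solver.Ring.NaturalCoefficients.Default commutativeSemiring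

  complement-split : ∀ a x → (1# - a) * x + a * x ≈ x
  complement-split a x = begin
    (1# - a) * x + a * x ≈⟨ distribʳ x (1# - a) a ⟨
    (1# - a + a) * x     ≈⟨ *-congʳ (trans (+-assoc 1# (- a) a) (trans (+-congˡ (-‿inverseˡ a)) (+-identityʳ 1#))) ⟩
    1# * x               ≈⟨ *-identityˡ x ⟩
    x                    ∎

  rowSum : ℕ → ℕ → Carrier
  rowSum o zero    = 0#
  rowSum o (suc l) = pow ω (suc l ℕ.+ o) + rowSum o l

  rowsSum : List ℕ → Carrier
  rowsSum []       = 0#
  rowsSum (x ∷ xs) = rowSum (length xs) x + rowsSum xs

  powerSum : List ℕ → Carrier
  powerSum []       = 0#
  powerSum (p ∷ ps) = pow ω p + powerSum ps

  row-geometric : ∀ o l → (1# - ω) * rowSum o l + pow ω (suc (l ℕ.+ o)) ≈ pow ω (suc o)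
  row-geometric o zero    = trans (+-congʳ (zeroʳ _)) (+-identityˡ _)
  row-geometric o (suc l) = begin
    (1# - ω) * (x + rowSum o l) + ω * x       ≈⟨ regroup (1# - ω) x (rowSum o l) ω ⟩
    ((1# - ω) * x + ω * x) + (1# - ω) * rowSum o l ≈⟨ +-congʳ (complement-split ω x) ⟩
    x + (1# - ω) * rowSum o l                 ≈⟨ +-comm _ _ ⟩
    (1# - ω) * rowSum o l + x                 ≈⟨ row-geometric o l ⟩
    pow ω (suc o)                             ∎
    where
    x = pow ω (suc (l ℕ.+ o))
    regroup : ∀ u x r w → u * (x + r) + w * x ≈ (u * x + w * x) + u * r
    regroup = solve 4 (λ u x r w → u :* (x :+ r) :+ w :* x := (u :* x :+ w :* x) :+ u :* r) refl

  rows-geometric : ∀ ℓ → (1# - ω) * rowsSum ℓ + ω * powerSum (beta ℓ) ≈ ω * powerSum (downFrom (length ℓ))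
  rows-geometric []       = trans (+-cong (zeroʳ _) (zeroʳ _)) (trans (+-identityʳ 0#) (sym (zeroʳ _)))
  rows-geometric (x ∷ xs) = begin
    u * (rowSum o x + rowsSum xs) + ω * (pow ω (x ℕ.+ o) + powerSum (beta xs))
      ≈⟨ interchange u (rowSum o x) (rowsSum xs) ω (pow ω (x ℕ.+ o)) (powerSum (beta xs)) ⟩
    (u * rowSum o x + pow ω (suc (x ℕ.+ o))) + (u * rowsSum xs + ω * powerSum (beta xs))
      ≈⟨ +-cong (row-geometric o x) (rows-geometric xs) ⟩
    pow ω (suc o) + ω * powerSum (downFrom o)   ≈⟨ distribˡ ω _ _ ⟨
    ω * (pow ω o + powerSum (downFrom o))      ∎
    where
    u = 1# - ω
    o = length xs
    interchange : ∀ u a b w p q → u * (a + b) + w * (p + q) ≈ (u * a + w * p) + (u * b + w * q)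
    interchange = solve 6 (λ u a b w p q → u :* (a :+ b) :+ w :* (p :+ q) := (u :* a :+ w :* p) :+ (u :* b :+ w :* q)) refl

  module _ (t′ : ℕ) where

    open Abacus t′

    -- Σ_{k<t} ω^{k + t·c_k(Q)}, c_k(Q) the number of beads of Q on runner k:
    -- each runner contributes the power just above its topmost bead.
    runnerSum : List ℕ → Carrier
    runnerSum Q = sumTo t (λ k → pow ω k * pow ω (runner-count k Q ℕ.* t))

    -- A strictly decreasing shift-closed Q fills each runner k from the bottom,
    -- with beads k, k+t, …, so (1 - ω^t) Σ_{p∈Q} ω^p = Σ_k ω^k - runnerSum Q.
    shift-closed-sum : ∀ Q → AllPairs _>_ Q → ShiftClosed t Q →
      (1# - pow ω t) * powerSum Q + runnerSum Q ≈ sumTo t (pow ω)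
    shift-closed-sum [] _ _ = begin
      (1# - pow ω t) * 0# + runnerSum [] ≈⟨ +-congʳ (zeroʳ _) ⟩
      0# + runnerSum []                   ≈⟨ +-identityˡ _ ⟩
      runnerSum []                        ≈⟨ sumTo-cong t (λ k _ → *-identityʳ (pow ω k)) ⟩
      sumTo t (pow ω)                     ∎
    shift-closed-sum (p ∷ Q) decr@(p>Q ∷ Q-decr) closed = +-cancelʳ (pow ω p) _ _ (begin
      (u * (pow ω p + powerSum Q) + runnerSum (p ∷ Q)) + pow ω p
        ≈⟨ regroup u (pow ω p) (powerSum Q) (runnerSum (p ∷ Q)) ⟩
      (u * pow ω p + u * powerSum Q) + (runnerSum (p ∷ Q) + pow ω p)
        ≈⟨ +-congˡ raise-runner ⟩
      (u * pow ω p + u * powerSum Q) + (runnerSum Q + pow ω p * pow ω t)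
        ≈⟨ regroup′ u (pow ω p) (powerSum Q) (runnerSum Q) (pow ω t) ⟩
      (u * pow ω p + pow ω t * pow ω p) + (u * powerSum Q + runnerSum Q)
        ≈⟨ +-cong (complement-split (pow ω t) (pow ω p)) (shift-closed-sum Q Q-decr Q-closed) ⟩
      pow ω p + sumTo t (pow ω)   ≈⟨ +-comm _ _ ⟩
      sumTo t (pow ω) + pow ω p   ∎)
      where
      open import Algebra.Properties.Ring ring using (+-cancelʳ)
      u = 1# - pow ω t
      a = p % t
      Q-closed = tail-shift-closed decr closed
      -- p is the next bead on its runner a: p = a + t·c_a(Q)
      top-bead : runner-count a Q ≡ p / t
      top-bead = runner-count-below Q p Q-decr Q-closed p>Q (head-shift closed)
      term : ℕ → ℕ → Carrier
      term k b = pow ω k * pow ω ((b ℕ.+ runner-count k Q) ℕ.* t)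
      term-a-0 : term a 0 ≈ pow ω p
      term-a-0 = begin
        pow ω a * pow ω (runner-count a Q ℕ.* t) ≈⟨ ≡⇒≈ (≡.cong (λ c → pow ω a * pow ω (c ℕ.* t)) top-bead) ⟩
        pow ω a * pow ω (p / t ℕ.* t)            ≈⟨ pow-+ ω a _ ⟨
        pow ω (a ℕ.+ p / t ℕ.* t)                ≈⟨ ≡⇒≈ (≡.cong (pow ω) (≡.sym (m≡m%n+[m/n]*n p t))) ⟩
        pow ω p                                  ∎
      term-a-1 : term a 1 ≈ pow ω p * pow ω t
      term-a-1 = begin
        pow ω a * pow ω (t ℕ.+ runner-count a Q ℕ.* t)       ≈⟨ *-congˡ (pow-+ ω t _) ⟩
        pow ω a * (pow ω t * pow ω (runner-count a Q ℕ.* t)) ≈⟨ rotate (pow ω a) (pow ω t) _ ⟩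
        term a 0 * pow ω t                                   ≈⟨ *-congʳ term-a-0 ⟩
        pow ω p * pow ω t                                    ∎
        where
        rotate : ∀ x y z → x * (y * z) ≈ (x * z) * y
        rotate = solve 3 (λ x y z → x :* (y :* z) := (x :* z) :* y) refl
      -- adding p moves the top of runner a up by t
      raise-runner : runnerSum (p ∷ Q) + pow ω p ≈ runnerSum Q + pow ω p * pow ω t
      raise-runner = begin
        runnerSum (p ∷ Q) + pow ω p ≈⟨ +-congˡ term-a-0 ⟨
        sumTo t (λ k → term k (δ a k)) + term a 0 ≈⟨ sumTo-δ-exchange t a (m%n<n p t) term ⟩
        runnerSum Q + term a 1      ≈⟨ +-congˡ term-a-1 ⟩
        runnerSum Q + pow ω p * pow ω t ∎
      regroup : ∀ u x y g → (u * (x + y) + g) + x ≈ (u * x + u * y) + (g + x)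
      regroup = solve 4 (λ u x y g → (u :* (x :+ y) :+ g) :+ x := (u :* x :+ u :* y) :+ (g :+ x)) refl
      regroup′ : ∀ u x y g w → (u * x + u * y) + (g + x * w) ≈ (u * x + w * x) + (u * y + g)
      regroup′ = solve 5 (λ u x y g w → (u :* x :+ u :* y) :+ (g :+ x :* w) := (u :* x :+ w :* x) :+ (u :* y :+ g)) refl

module GBGRankIdentity {r₁ r₂} (R : CommutativeRing r₁ r₂) (s′ : ℕ) (ω : CommutativeRing.Carrier R)
  (ωˢ≈1 : CommutativeRing._≈_ R (RingDefs.pow R ω (suc s′)) (CommutativeRing.1# R)) where

  open CommutativeRing R
  open RingDefs R
  open RingSums R
  open GeometricSums R ω
  open SameDiagram using (pad; pad-linked; pad-length)
  open BetaNumbers using (beta; beta-decreasing; core⇒shift-closed)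
  open Integers using (%ℕ-shift; content-exponent; twisted-exponent)
  open Counting using (δ; downFrom-decreasing; downFrom-shift-closed; rowsCount-pad)
  open import Data.Nat as ℕ using (zero; _<_; z≤n; s≤s; _%_; _/_)
  import Data.Nat.Properties as ℕP
  open import Data.Nat.DivMod using (m≡m%n+[m/n]*n)
  open import Data.Integer as ℤ using (_%ℕ_)
  open import Data.Integer.DivMod using (n%ℕd<d)
  open import Data.List using ([]; _∷_; length; downFrom)
  open import Data.Product using (proj₂)
  open import Relation.Binary.PropositionalEquality as ≡ using (_≡_)
  open import Relation.Binary.Reasoning.Setoid setoid
  open import Algebra.Solver.Ring.NaturalCoefficients.Default commutativeSemiring

  s : ℕ
  s = suc s′

  pow-mod : ∀ n → pow ω n ≈ pow ω (n % s)
  pow-mod n = begin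
    pow ω n                              ≈⟨ ≡⇒≈ (≡.cong (pow ω) (m≡m%n+[m/n]*n n s)) ⟩
    pow ω (n % s ℕ.+ n / s ℕ.* s)        ≈⟨ pow-+ ω (n % s) _ ⟩
    pow ω (n % s) * pow ω (n / s ℕ.* s)  ≈⟨ *-congˡ (pow-multiple ω s ωˢ≈1 (n / s)) ⟩
    pow ω (n % s) * 1#                   ≈⟨ *-identityʳ _ ⟩
    pow ω (n % s)                        ∎

  powℤ-shift : ∀ z K n → z ℤ.+ ℤ.+ (K ℕ.* s) ≡ ℤ.+ n → powℤ s ω z ≈ pow ω n
  powℤ-shift z K n e = trans (≡⇒≈ (≡.cong (pow ω) (%ℕ-shift s z K n e))) (sym (pow-mod n))

  -- For a diagram with N rows (after padding), the factor W = ω^{N s′} plays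
  -- the role of ω^{-N}.
  module Padded (N : ℕ) where

    W : Carrier
    W = pow ω (N ℕ.* s′)

    W-inverse : W * pow ω N ≈ 1#
    W-inverse = begin
      W * pow ω N             ≈⟨ pow-+ ω (N ℕ.* s′) N ⟨
      pow ω (N ℕ.* s′ ℕ.+ N)  ≈⟨ ≡⇒≈ (≡.cong (pow ω) (≡.trans (ℕP.+-comm (N ℕ.* s′) N) (≡.sym (ℕP.*-suc N s′)))) ⟩
      pow ω (N ℕ.* s)         ≈⟨ pow-multiple ω s ωˢ≈1 N ⟩
      1#                      ∎

    cell-power : ∀ j i o → i ℕ.+ o ≡ N → powℤ s ω (ℤ.+ j ℤ.- ℤ.+ i) ≈ W * pow ω (j ℕ.+ o)
    cell-power j i o e = begin
      powℤ s ω (ℤ.+ j ℤ.- ℤ.+ i)      ≈⟨ powℤ-shift (ℤ.+ j ℤ.- ℤ.+ i) N (j ℕ.+ o ℕ.+ N ℕ.* s′) exponent ⟩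
      pow ω (j ℕ.+ o ℕ.+ N ℕ.* s′)    ≈⟨ pow-+ ω (j ℕ.+ o) _ ⟩
      pow ω (j ℕ.+ o) * W             ≈⟨ *-comm _ _ ⟩
      W * pow ω (j ℕ.+ o)             ∎
      where
      exponent : (ℤ.+ j ℤ.- ℤ.+ i) ℤ.+ ℤ.+ (N ℕ.* s) ≡ ℤ.+ (j ℕ.+ o ℕ.+ N ℕ.* s′)
      exponent = ≡.subst (λ M → (ℤ.+ j ℤ.- ℤ.+ i) ℤ.+ ℤ.+ (M ℕ.* s) ≡ ℤ.+ (j ℕ.+ o ℕ.+ M ℕ.* s′)) e
                   (content-exponent j i o s′)

    row-rank : ∀ i o l → i ℕ.+ o ≡ N → sumTo s (λ k → fromℕ (rowCount s k i l) * pow ω k) ≈ W * rowSum o l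
    row-rank i o zero    e = trans (sumTo-weighted-0 s (pow ω)) (sym (zeroʳ W))
    row-rank i o (suc l) e = begin
      sumTo s (λ k → fromℕ (δ a k ℕ.+ rowCount s k i l) * pow ω k)
        ≈⟨ sumTo-weighted-+ s (δ a) (λ k → rowCount s k i l) (pow ω) ⟩
      sumTo s (λ k → fromℕ (δ a k) * pow ω k) + sumTo s (λ k → fromℕ (rowCount s k i l) * pow ω k)
        ≈⟨ +-cong (sumTo-δ s a (n%ℕd<d (ℤ.+ suc l ℤ.- ℤ.+ i) s) (pow ω)) (row-rank i o l e) ⟩
      pow ω a + W * rowSum o l             ≈⟨ +-congʳ (cell-power (suc l) i o e) ⟩
      W * pow ω (suc l ℕ.+ o) + W * rowSum o l ≈⟨ distribˡ W _ _ ⟨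
      W * rowSum o (suc l)                 ∎
      where
      a = (ℤ.+ suc l ℤ.- ℤ.+ i) %ℕ s

    rows-rank : ∀ i ℓ → i ℕ.+ length ℓ ≡ suc N →
      sumTo s (λ k → fromℕ (rowsCount s k i ℓ) * pow ω k) ≈ W * rowsSum ℓ
    rows-rank i []       e = trans (sumTo-weighted-0 s (pow ω)) (sym (zeroʳ W))
    rows-rank i (x ∷ xs) e = begin
      sumTo s (λ k → fromℕ (rowCount s k i x ℕ.+ rowsCount s k (suc i) xs) * pow ω k)
        ≈⟨ sumTo-weighted-+ s (λ k → rowCount s k i x) (λ k → rowsCount s k (suc i) xs) (pow ω) ⟩
      _ ≈⟨ +-cong (row-rank i (length xs) x e′) (rows-rank (suc i) xs (≡.cong suc e′)) ⟩
      W * rowSum (length xs) x + W * rowsSum xs ≈⟨ distribˡ W _ _ ⟨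
      W * rowsSum (x ∷ xs) ∎
      where
      e′ : i ℕ.+ length xs ≡ N
      e′ = ℕP.suc-injective (≡.trans (≡.sym (ℕP.+-suc i (length xs))) e)

  module _ (t′ : ℕ) where

    open Abacus t′ using (t; runner-count; runner-count-downFrom; n-formula)

    twisted-power : ∀ L c → powℤ s ω (ℤ.+ t ℤ.* (ℤ.+ c ℤ.- ℤ.+ L)) ≈ pow ω (c ℕ.* t) * Padded.W (L ℕ.* t)
    twisted-power L c =
      trans (powℤ-shift (ℤ.+ t ℤ.* (ℤ.+ c ℤ.- ℤ.+ L)) (L ℕ.* t) _ (twisted-exponent t c L s′)) (pow-+ ω (c ℕ.* t) _)

    numerator-term : ∀ π ℓ L → length ℓ ≡ L ℕ.* t → (∀ m .{{_ : ℕ.NonZero m}} k → r k π m ≡ r k ℓ m) →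
      ∀ i → i < t → pow ω (suc i) * (powℤ s ω (ℤ.+ t ℤ.* nn i π t) - 1#)
                  ≈ (ω * Padded.W (L ℕ.* t)) * (pow ω i * pow ω (runner-count i (beta ℓ) ℕ.* t)) - ω * pow ω i
    numerator-term π ℓ L length-ℓ same-counts i i<t = begin
      pow ω (suc i) * (powℤ s ω (ℤ.+ t ℤ.* nn i π t) - 1#)
        ≈⟨ *-congˡ (+-congʳ (≡⇒≈ (≡.cong (λ n → powℤ s ω (ℤ.+ t ℤ.* n)) nᵢ))) ⟩
      pow ω (suc i) * (powℤ s ω (ℤ.+ t ℤ.* (ℤ.+ c ℤ.- ℤ.+ L)) - 1#)
        ≈⟨ *-congˡ (+-congʳ (twisted-power L c)) ⟩
      pow ω (suc i) * (pow ω (c ℕ.* t) * W - 1#)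
        ≈⟨ x[y-z]≈xy-xz _ _ _ ⟩
      pow ω (suc i) * (pow ω (c ℕ.* t) * W) - pow ω (suc i) * 1#
        ≈⟨ +-cong (regroup ω (pow ω i) (pow ω (c ℕ.* t)) W) (-‿cong (*-identityʳ _)) ⟩
      (ω * W) * (pow ω i * pow ω (c ℕ.* t)) - ω * pow ω i ∎
      where
      open import Algebra.Properties.Ring ring using (x[y-z]≈xy-xz)
      W = Padded.W (L ℕ.* t)
      c = runner-count i (beta ℓ)
      nᵢ : nn i π t ≡ ℤ.+ c ℤ.- ℤ.+ L
      nᵢ = ≡.trans (≡.cong₂ (λ a b → ℤ.+ a ℤ.- ℤ.+ b) (same-counts t i) (same-counts t (suc i ℕ.% t)))
                   (n-formula L ℓ i i<t length-ℓ)
      regroup : ∀ w a b W → (w * a) * (b * W) ≈ (w * W) * (a * b)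
      regroup = solve 4 (λ w a b W → (w :* a) :* (b :* W) := (w :* W) :* (a :* b)) refl

    -- Every runner of the N = L·t row offsets is full up to N, so their runner
    -- sum is ω^N Σ_k ω^k.
    offsets-top : ∀ L → Padded.W (L ℕ.* t) * runnerSum t′ (downFrom (L ℕ.* t)) ≈ sumTo t (pow ω)
    offsets-top L = begin
      W * runnerSum t′ (downFrom N)          ≈⟨ *-congˡ (sumTo-cong t λ k k<t →
                                                 trans (≡⇒≈ (≡.cong (λ c → pow ω k * pow ω (c ℕ.* t)) (runner-count-downFrom L k k<t)))
                                                       (*-comm _ _)) ⟩
      W * sumTo t (λ k → pow ω N * pow ω k)  ≈⟨ *-congˡ (sumTo-*ˡ t (pow ω N) (pow ω)) ⟩
      W * (pow ω N * sumTo t (pow ω))        ≈⟨ *-assoc _ _ _ ⟨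
      (W * pow ω N) * sumTo t (pow ω)        ≈⟨ *-congʳ W-inverse ⟩
      1# * sumTo t (pow ω)                   ≈⟨ *-identityˡ _ ⟩
      sumTo t (pow ω)                        ∎
      where
      N = L ℕ.* t
      open Padded N using (W; W-inverse)

    numerator-runners : ∀ π ℓ L → length ℓ ≡ L ℕ.* t → (∀ m .{{_ : ℕ.NonZero m}} k → r k π m ≡ r k ℓ m) →
      numerator π s t ω ≈ (ω * Padded.W (L ℕ.* t)) * runnerSum t′ (beta ℓ) - ω * sumTo t (pow ω)
    numerator-runners π ℓ L length-ℓ same-counts = begin
      numerator π s t ω
        ≈⟨ sumTo-cong t (numerator-term π ℓ L length-ℓ same-counts) ⟩
      sumTo t (λ i → (ω * W) * (pow ω i * pow ω (runner-count i (beta ℓ) ℕ.* t)) - ω * pow ω i)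
        ≈⟨ sumTo-- t _ _ ⟩
      sumTo t (λ i → (ω * W) * (pow ω i * pow ω (runner-count i (beta ℓ) ℕ.* t))) - sumTo t (λ i → ω * pow ω i)
        ≈⟨ +-cong (sumTo-*ˡ t (ω * W) _) (-‿cong (sumTo-*ˡ t ω (pow ω))) ⟩
      (ω * W) * runnerSum t′ (beta ℓ) - ω * sumTo t (pow ω) ∎
      where W = Padded.W (L ℕ.* t)

    gbg-times-denominator : ∀ π → IsPartition π → IsCore t π →
      GBGrank π s ω * denominator t ω ≈ numerator π s t ω
    gbg-times-denominator π π-partition core = begin
      GBGrank π s ω * ((1# - ω) * (1# - pow ω t)) ≈⟨ *-congʳ rank ⟩
      (W * rowsSum ℓ) * ((1# - ω) * (1# - pow ω t))
        ≈⟨ eliminate ω W (rowsSum ℓ) (1# - ω) (1# - pow ω t) (powerSum (beta ℓ)) (powerSum (downFrom N))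
                     (runnerSum t′ (beta ℓ)) (runnerSum t′ (downFrom N)) (sumTo t (pow ω))
                     rows beads offsets (offsets-top L) ⟩
      (ω * W) * runnerSum t′ (beta ℓ) - ω * sumTo t (pow ω) ≈⟨ numerator-runners π ℓ L length-ℓ same-counts ⟨
      numerator π s t ω                                     ∎
      where
      L = length π
      N = L ℕ.* t
      open Padded N using (W; rows-rank)
      ℓ = pad π (N ℕ.∸ L)
      length-ℓ : length ℓ ≡ N
      length-ℓ = pad-length π (ℕP.m≤m*n L t)
      same-counts : ∀ m .{{_ : ℕ.NonZero m}} k → r k π m ≡ r k ℓ m
      same-counts m k = ≡.sym (rowsCount-pad m k 1 π (N ℕ.∸ L))
      rank : GBGrank π s ω ≈ W * rowsSum ℓ
      rank = trans (sumTo-cong s (λ k _ → ≡⇒≈ (≡.cong (λ n → fromℕ n * pow ω k) (same-counts s k))))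
                   (rows-rank 1 ℓ (≡.cong suc length-ℓ))
      rows : (1# - ω) * rowsSum ℓ + ω * powerSum (beta ℓ) ≈ ω * powerSum (downFrom N)
      rows = ≡.subst (λ n → (1# - ω) * rowsSum ℓ + ω * powerSum (beta ℓ) ≈ ω * powerSum (downFrom n))
               length-ℓ (rows-geometric ℓ)
      beads : (1# - pow ω t) * powerSum (beta ℓ) + runnerSum t′ (beta ℓ) ≈ sumTo t (pow ω)
      beads = shift-closed-sum t′ (beta ℓ) (beta-decreasing ℓ (pad-linked π (N ℕ.∸ L) (proj₂ π-partition)))
                (core⇒shift-closed t π (N ℕ.∸ L) (s≤s z≤n) π-partition core)
      offsets : (1# - pow ω t) * powerSum (downFrom N) + runnerSum t′ (downFrom N) ≈ sumTo t (pow ω)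
      offsets = shift-closed-sum t′ (downFrom N) (downFrom-decreasing N) (downFrom-shift-closed t N)

theorem1p1 : ∀ {c ℓ : Level} (R : CommutativeRing c ℓ)
    (s t : ℕ) .{{_ : NonZero s}} .{{_ : NonZero t}} → 1 < s → 1 < t → gcd s t ≡ 1 →
    (ω : CommutativeRing.Carrier R) → RingDefs.PrimitiveRoot R s ω →
    (d : CommutativeRing.Carrier R) →
    CommutativeRing._≈_ R (CommutativeRing._*_ R d (RingDefs.denominator R t ω)) (CommutativeRing.1# R) →
    (π : List ℕ) → IsPartition π → IsCore t π →
    CommutativeRing._≈_ R (RingDefs.GBGrank R π s ω)
    (CommutativeRing._*_ R (RingDefs.numerator R π s t ω) d)
theorem1p1 R (suc s′) (suc t′) _ _ _ ω (ωˢ≈1 , _) d d·den≈1 π π-partition core =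
  RingSums.divide R _ _ _ d (GBGRankIdentity.gbg-times-denominator R s′ ω ωˢ≈1 t′ π π-partition core) d·den≈1
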